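{- Let $G$ be the skeleton of a perforated patch whose hole perimeters $C_1,\dots,C_k$ form an admissible structure $(G;C_1,\dots,C_k)$, and assume $G$ has at least one Kekul\'e structure. Let $\mathbf{n}=(n_1,\dots,n_k)$ be a vector of non-negative integers and $G'=A^{\mathbf{n}}(G;C_1,\dots,C_k)$, which contains $G$ as a subgraph in the natural way. Then the Pauling bond order in $G'$ of a newly obtained edge $e$ (an edge of $G'$ not in $G$) is $0$ if $e$ is a spoke and $\tfrac12$ if $e$ is not a spoke. The Pauling bond order of every edge of $G$ is the same in $G'$ as in $G$.
   Context: A Kekul\'e structure is a perfect matching; the Pauling bond order of an edge $e$ in a graph with $K>0$ Kekul\'e structures is the number of Kekul\'e structures containing $e$ divided by $K$. A perforated patch is a connected proper subset $\mathcal{P}$ of the face set of a finite plane cubic simple graph $G_0$ (connected: any two faces of $\mathcal{P}$ are joined by a sequence of faces of $\mathcal{P}$, consecutive ones distinct and sharing an edge); its skeleton is the subgraph of $G_0$ of all vertices and edges on the boundary of some face of $\mathcal{P}$; its holes are the connected components of the complement, with perimeters their boundaries with $\mathcal{P}$. Altan: if $H$ is a graph and $C$ a cycle of $H$ containing $d\ge2$ degree-2 vertices $v_1,\dots,v_d$ (in cyclic order along $C$), $A(H,C)$ is obtained by adding a new cycle $w_1x_1w_2x_2\cdots w_dx_dw_1$ on $2d$ new vertices and the edges $v_iw_i$, called spokes. $(H;C_1,\dots,C_k)$ is admissible if each $C_i$ contains at least two degree-2 vertices of $H$ and each degree-2 vertex of $H$ lies on at most one $C_i$. $A^{\mathbf{n}}(H;C_1,\dots,C_k)$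 is obtained by performing the altan operation $n_i$ times at position $i$, each time replacing the cycle at position $i$ by the newly created cycle; spokes of $G'$ are all spokes added in any of these operations. -}

module Defs where

open import Data.Bool using (Bool; true; false; _∧_; _∨_; if_then_else_; not)
open import Data.Nat using (ℕ; zero; suc; _+_; _*_; _≤_; _≡ᵇ_; _≤ᵇ_)
open import Data.Fin using (Fin; zero; suc; toℕ; splitAt; _↑ˡ_; _↑ʳ_; _≟_)
open import Data.Fin.Properties using ()
open import Data.List using (List; []; _∷_; _++_; length; map; concatMap; filterᵇ; zip; lookup; allFin; foldl)
open import Data.List.Membership.Propositional using (_∈_)
open import Data.List.Relation.Unary.Unique.Propositional using (Unique)
open import Data.Product using (_×_; _,_; Σ; ∃; proj₁; proj₂)
open import Data.Sum using (_⊎_; inj₁; inj₂)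
open import Data.Integer using (+_)
open import Data.Rational using (ℚ; 0ℚ; _/_)
open import Relation.Nullary using (¬_)
open import Relation.Nullary.Decidable using (⌊_⌋)
open import Relation.Binary.PropositionalEquality using (_≡_; _≢_)
open import Relation.Binary.Construct.Closure.ReflexiveTransitive using (Star)

allF : {m : ℕ} → (Fin m → Bool) → Bool
allF {zero}  p = true
allF {suc m} p = p zero ∧ allF (λ i → p (suc i))

anyF : {m : ℕ} → (Fin m → Bool) → Bool
anyF {zero}  p = false
anyF {suc m} p = p zero ∨ anyF (λ i → p (suc i))

countF : {m : ℕ} → (Fin m → Bool) → ℕ
countF {zero}  p = 0
countF {suc m} p = (if p zero then 1 else 0) + countF (λ i → p (suc i))

sumF : {m : ℕ} → (Fin m → ℕ) → ℕ
sumF {zero}  f = 0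
sumF {suc m} f = f zero + sumF (λ i → f (suc i))

_⇒ᵇ_ : Bool → Bool → Bool
a ⇒ᵇ b = not a ∨ b

_==ᵇ_ : Bool → Bool → Bool
true  ==ᵇ b = b
false ==ᵇ b = not b

_=F_ : {m : ℕ} → Fin m → Fin m → Bool
x =F y = ⌊ x ≟ y ⌋

allFuns : {A : Set} (m : ℕ) → List A → List (Fin m → A)
allFuns zero    xs = (λ ()) ∷ []
allFuns (suc m) xs =
  concatMap (λ a → map (λ f → λ { zero → a ; (suc i) → f i }) (allFuns m xs)) xs

-- Finite simple graphs, given as a vertex set and an edge set
-- (symmetric adjacency) inside an ambient vertex type Fin V.

record Graph : Set where
  field
    V    : ℕ
    vert : Fin V → Bool
    adj  : Fin V → Fin V → Bool

deg : (G : Graph) → Fin (Graph.V G) → ℕ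
deg G v = countF (Graph.adj G v)

IsKekuleᵇ : (G : Graph) → (Fin (Graph.V G) → Fin (Graph.V G) → Bool) → Bool
IsKekuleᵇ G M =
  allF (λ u → allF (λ v → (M u v ⇒ᵇ Graph.adj G u v) ∧ (M u v ==ᵇ M v u)))
  ∧ allF (λ v → Graph.vert G v ⇒ᵇ (countF (M v) ≡ᵇ 1))

kekuleStructures : (G : Graph) → List (Fin (Graph.V G) → Fin (Graph.V G) → Bool)
kekuleStructures G =
  filterᵇ (IsKekuleᵇ G) (allFuns (Graph.V G) (allFuns (Graph.V G) (true ∷ false ∷ [])))

numKekule : Graph → ℕ
numKekule G = length (kekuleStructures G)

numKekuleContaining : (G : Graph) → Fin (Graph.V G) → Fin (Graph.V G) → ℕ
numKekuleContaining G u v = length (filterᵇ (λ M → M u v) (kekuleStructures G))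

-- Pauling bond order of uv (only meaningful when K(G) > 0; set to 0 otherwise)
paulingAux : ℕ → ℕ → ℚ
paulingAux c zero    = 0ℚ
paulingAux c (suc K) = (+ c) / suc K

pauling : (G : Graph) → Fin (Graph.V G) → Fin (Graph.V G) → ℚ
pauling G u v = paulingAux (numKekuleContaining G u v) (numKekule G)

-- Plane cubic simple graphs as rotation systems.
-- Vertices Fin n; nbr v i (i : Fin 3) lists the three neighbours of v in
-- cyclic (rotation) order. Darts are pairs (v , i) = the edge from v to nbr v i.

suc3 : Fin 3 → Fin 3
suc3 zero = suc zero
suc3 (suc zero) = suc (suc zero)
suc3 (suc (suc zero)) = zero

Dart : ℕ → Set
Dart n = Fin n × Fin 3

module Rot (n : ℕ) (nbr : Fin n → Fin 3 → Fin n) where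

  revIdx : Fin n → Fin 3 → Fin 3
  revIdx v i with nbr (nbr v i) zero =F v | nbr (nbr v i) (suc zero) =F v
  ... | true  | _     = zero
  ... | false | true  = suc zero
  ... | false | false = suc (suc zero)

  rev : Dart n → Dart n
  rev (v , i) = nbr v i , revIdx v i

  -- face-tracing permutation: its orbits are the faces of the embedding
  φ : Dart n → Dart n
  φ (v , i) = nbr v i , suc3 (revIdx v i)

  φ^ : ℕ → Dart n → Dart n
  φ^ zero    d = d
  φ^ (suc k) d = φ (φ^ k d)

  dartIndex : Dart n → ℕ
  dartIndex (v , i) = 3 * toℕ v + toℕ i

  -- d is the least dart of its φ-orbit (orbits have size ≤ 3n)
  orbitMinᵇ : Dart n → Bool
  orbitMinᵇ d = allF {3 * n} (λ k → dartIndex d ≤ᵇ dartIndex (φ^ (toℕ k) d))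

  numFaces : ℕ
  numFaces = sumF (λ v → countF (λ i → orbitMinᵇ (v , i)))

  data Adj0 : Fin n → Fin n → Set where
    adj0 : ∀ v i → Adj0 v (nbr v i)

  data FStep (Q : Dart n → Bool) (b : Bool) : Dart n → Dart n → Set where
    along : ∀ d → Q d ≡ b → Q (φ d) ≡ b → FStep Q b d (φ d)
    cross : ∀ d → Q d ≡ b → Q (rev d) ≡ b → FStep Q b d (rev d)

  FConn : (Dart n → Bool) → Bool → Dart n → Dart n → Set
  FConn Q b = Star (FStep Q b)

record PlaneCubicGraph : Set where
  field
    n         : ℕ
    nbr       : Fin n → Fin 3 → Fin n
    loopless  : ∀ v i → nbr v i ≢ v
    noMulti   : ∀ v i j → nbr v i ≡ nbr v j → i ≡ j
    symmetric : ∀ v i → ∃ λ j → nbr (nbr v i) j ≡ v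
    connected : ∀ u v → Star (Rot.Adj0 n nbr) u v
    -- genus 0 (Euler): V - E + F = 2 with E = 3n/2, i.e. 2F = n + 4
    planar    : 2 * Rot.numFaces n nbr ≡ n + 4
  open Rot n nbr public

-- Perforated patches: a set of faces, given as a φ-invariant predicate on darts.

module _ (G0 : PlaneCubicGraph) where
  open PlaneCubicGraph G0

  record IsPerforatedPatch (P : Dart n → Bool) : Set where
    field
      setOfFaces : ∀ d → P (φ d) ≡ P d
      nonempty   : ∃ λ d → P d ≡ true
      proper     : ∃ λ d → P d ≡ false
      conn       : ∀ d d' → P d ≡ true → P d' ≡ true → FConn P true d d'

  skeleton : (Dart n → Bool) → Graph
  skeleton P = record
    { V    = n
    ; vert = λ v → anyF (λ i → P (v , i))
    ; adj  = λ u v → anyF (λ i → (nbr u i =F v) ∧ (P (u , i) ∨ P (rev (u , i)))) }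

  -- Holes are FConn P false -components; a hole is represented by a dart h of it.
  -- uv is an edge of the perimeter of the hole of h: it separates a face of P
  -- from a face of that hole.
  PerimEdge : (Dart n → Bool) → Dart n → Fin n → Fin n → Set
  PerimEdge P h u v = Σ (Fin 3) λ a → nbr u a ≡ v ×
    ((P (u , a) ≡ true × FConn P false h (rev (u , a)))
     ⊎ (P (rev (u , a)) ≡ true × FConn P false h (u , a)))

-- Cycles given as lists of vertices in cyclic order

cycPairs : {A : Set} → List A → List (A × A)
cycPairs []       = []
cycPairs (x ∷ xs) = zip (x ∷ xs) (xs ++ (x ∷ []))

CycEdge : {A : Set} → List A → A → A → Set
CycEdge C u v = ((u , v) ∈ cycPairs C) ⊎ ((v , u) ∈ cycPairs C)

IsCycle : (G : Graph) → List (Fin (Graph.V G)) → Set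
IsCycle G C = 3 ≤ length C × Unique C × (∀ v → v ∈ C → Graph.vert G v ≡ true)
  × (∀ u v → CycEdge C u v → Graph.adj G u v ≡ true)

deg2On : (G : Graph) → List (Fin (Graph.V G)) → List (Fin (Graph.V G))
deg2On G C = filterᵇ (λ v → Graph.vert G v ∧ (deg G v ≡ᵇ 2)) C

Admissible : (G : Graph) (k : ℕ) → (Fin k → List (Fin (Graph.V G))) → Set
Admissible G k C =
  (∀ i → IsCycle G (C i)) ×
  (∀ i → 2 ≤ length (deg2On G (C i))) ×
  (∀ i j v → v ∈ C i → v ∈ C j → Graph.vert G v ≡ true → deg G v ≡ 2 → i ≡ j)

record HolePerimeters (G0 : PlaneCubicGraph) (P : Dart (PlaneCubicGraph.n G0) → Bool)
    (k : ℕ) (C : Fin k → List (Fin (PlaneCubicGraph.n G0))) : Set where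
  open PlaneCubicGraph G0
  field
    hole      : Fin k → Dart n
    holeOut   : ∀ i → P (hole i) ≡ false
    distinct  : ∀ i j → FConn P false (hole i) (hole j) → i ≡ j
    exhaust   : ∀ d → P d ≡ false → ∃ λ i → FConn P false (hole i) d
    perimeter : ∀ i u v →
      (CycEdge (C i) u v → PerimEdge G0 P (hole i) u v) ×
      (PerimEdge G0 P (hole i) u v → CycEdge (C i) u v)

record AState (n k : ℕ) : Set where
  field
    V    : ℕ
    vert : Fin V → Bool
    adj  : Fin V → Fin V → Bool
    spk  : Fin V → Fin V → Bool
    emb  : Fin n → Fin V
    cyc  : Fin k → List (Fin V)

graphOf : ∀ {n k} → AState n k → Graph
graphOf s = record { V = AState.V s ; vert = AState.vert s ; adj = AState.adj s }

module AltanStep {n k : ℕ} (s : AState n k) (i : Fin k) where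
  open AState s
  vs : List (Fin V)
  vs = deg2On (graphOf s) (cyc i)
  d : ℕ
  d = length vs
  -- new vertex j : Fin (2d): j = 2(p) is w_{p+1}, j = 2p+1 is x_{p+1};
  -- new cycle w_1 x_1 w_2 x_2 … w_d x_d w_1
  newAdj : Fin (2 * d) → Fin (2 * d) → Bool
  newAdj j j' = (suc (toℕ j) ≡ᵇ toℕ j') ∨ (suc (toℕ j') ≡ᵇ toℕ j)
              ∨ ((toℕ j ≡ᵇ 0) ∧ (suc (toℕ j') ≡ᵇ 2 * d))
              ∨ ((toℕ j' ≡ᵇ 0) ∧ (suc (toℕ j) ≡ᵇ 2 * d))
  spoke : Fin V → Fin (2 * d) → Bool
  spoke u j = anyF (λ p → (toℕ j ≡ᵇ 2 * toℕ p) ∧ (lookup vs p =F u))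
  adj' : Fin (V + 2 * d) → Fin (V + 2 * d) → Bool
  adj' x y with splitAt V x | splitAt V y
  ... | inj₁ u | inj₁ u' = adj u u'
  ... | inj₁ u | inj₂ j  = spoke u j
  ... | inj₂ j | inj₁ u  = spoke u j
  ... | inj₂ j | inj₂ j' = newAdj j j'
  spk' : Fin (V + 2 * d) → Fin (V + 2 * d) → Bool
  spk' x y with splitAt V x | splitAt V y
  ... | inj₁ u | inj₁ u' = spk u u'
  ... | inj₁ u | inj₂ j  = spoke u j
  ... | inj₂ j | inj₁ u  = spoke u j
  ... | inj₂ j | inj₂ j' = false
  vert' : Fin (V + 2 * d) → Bool
  vert' x with splitAt V x
  ... | inj₁ u = vert u
  ... | inj₂ _ = true
  result : AState n k
  result = record
    { V    = V + 2 * d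
    ; vert = vert'
    ; adj  = adj'
    ; spk  = spk'
    ; emb  = λ a → emb a ↑ˡ (2 * d)
    ; cyc  = λ i' → if i' =F i then map (V ↑ʳ_) (allFin (2 * d))
                                else map (_↑ˡ 2 * d) (cyc i') }

altanAt : ∀ {n k} → AState n k → Fin k → AState n k
altanAt s i = AltanStep.result s i

iter : {A : Set} → ℕ → (A → A) → A → A
iter zero    f a = a
iter (suc m) f a = f (iter m f a)

altanIter : ∀ {n k} → (Fin k → ℕ) → AState n k → AState n k
altanIter ns s0 = foldl (λ s i → iter (ns i) (λ t → altanAt t i) s) s0 (allFin _)

initState : (G : Graph) (k : ℕ) → (Fin k → List (Fin (Graph.V G))) → AState (Graph.V G) k
initState G k C = record
  { V = Graph.V G ; vert = Graph.vert G ; adj = Graph.adj G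
  ; spk = λ _ _ → false ; emb = λ a → a ; cyc = C }

-- In a Kekulé structure of the altan A(H, C) the new cycle w₁x₁…w_dx_d has its d vertices x_p of
-- degree 2, so going around the cycle the matching is forced to alternate, and parity shows that it
-- can only close up if no w_p uses its spoke. Hence a Kekulé structure of A(H, C) is exactly a
-- Kekulé structure of H together with one of the two perfect matchings of the new cycle: K doubles,
-- an old edge lies in twice as many structures, a spoke in none and a new cycle edge in K(H) of
-- them. So old bond orders are unchanged, spokes get 0 and new cycle edges ½. The new cycle again
-- has d ≥ 2 vertices of degree 2 and the other cycles keep theirs, so the step iterates. Only
-- admissibility and K(G) > 0 are used.

module Submission where

open import Defs
open import Data.Bool using (Bool; true; false; _∧_; _∨_; not; if_then_else_; T?)
open import Data.Bool.Properties
  using (∧-conicalˡ; ∧-conicalʳ; ∧-zeroʳ; ∧-identityʳ; ∨-comm; ∨-identityʳ; ¬-not; not-involutive; T-≡)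
open import Data.Fin using (Fin; zero; suc; toℕ; fromℕ<; splitAt; _↑ˡ_; _↑ʳ_; _≟_)
open import Data.Fin.Properties
  using (toℕ-fromℕ<; toℕ-injective; toℕ<n; splitAt-↑ˡ; splitAt-↑ʳ; splitAt⁻¹-↑ˡ; splitAt⁻¹-↑ʳ; ↑ˡ-injective)
open import Data.Integer using () renaming (+_ to ℤ+_)
import Data.Integer as ℤ
import Data.Integer.Properties as ℤ
open import Data.List using (List; []; _∷_; _++_; length; map; concatMap; filterᵇ; tabulate; lookup; allFin; foldl)
open import Data.List.Membership.Propositional using (_∈_)
open import Data.List.Membership.Propositional.Properties using (∈-filter⁻; ∈-lookup; ∈-map⁻)
open import Data.List.Relation.Unary.Any using (here; there)
open import Data.Nat using (ℕ; zero; suc; _+_; _*_; _∸_; _≤_; _<_; z≤n; s≤s; _≡ᵇ_; _<?_; pred; >-nonZero)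
open import Data.Nat.Properties hiding (_≟_)
open import Algebra.Properties.CommutativeSemigroup +-commutativeSemigroup
  using () renaming (interchange to +-interchange)
open import Data.Product using (_×_; _,_; proj₁; proj₂; Σ; ∃; ∃₂)
open import Data.Rational using (0ℚ; ½)
open import Data.Rational.Properties using (fromℚᵘ-cong; fromℚᵘ-toℚᵘ)
open import Data.Rational.Unnormalised using (mkℚᵘ; *≡*)
open import Data.Sum using (_⊎_; inj₁; inj₂)
open import Function using (_∘_)
open import Function.Bundles using (Equivalence)
open import Relation.Nullary using (¬_; yes; no)
open import Relation.Nullary.Negation using (contradiction)
open import Relation.Binary.PropositionalEquality

∧-intro : ∀ {x y} → x ≡ true → y ≡ true → x ∧ y ≡ true
∧-intro refl refl = refl

∨-introˡ : ∀ {x y} → x ≡ true → x ∨ y ≡ true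
∨-introˡ refl = refl

∨-introʳ : ∀ {x y} → y ≡ true → x ∨ y ≡ true
∨-introʳ {true}  _ = refl
∨-introʳ {false} e = e

∨-elim : ∀ {x y} → x ∨ y ≡ true → x ≡ true ⊎ y ≡ true
∨-elim {true}  _ = inj₁ refl
∨-elim {false} e = inj₂ e

⇒ᵇ-elim : ∀ {x y} → x ⇒ᵇ y ≡ true → x ≡ true → y ≡ true
⇒ᵇ-elim e refl = e

==ᵇ-refl : ∀ x → x ==ᵇ x ≡ true
==ᵇ-refl true  = refl
==ᵇ-refl false = refl

==ᵇ-true : ∀ x → (x ==ᵇ true) ≡ x
==ᵇ-true true  = refl
==ᵇ-true false = refl

==ᵇ-false : ∀ x → (x ==ᵇ false) ≡ not x
==ᵇ-false true  = refl
==ᵇ-false false = refl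

==ᵇ⇒≡ : ∀ {x y} → x ==ᵇ y ≡ true → x ≡ y
==ᵇ⇒≡ {true}  {true}  _ = refl
==ᵇ⇒≡ {false} {false} _ = refl

bool-ext : ∀ {x y} → (x ≡ true → y ≡ true) → (y ≡ true → x ≡ true) → x ≡ y
bool-ext {true}  {true}  _ _ = refl
bool-ext {true}  {false} f _ = sym (f refl)
bool-ext {false} {true}  _ g = g refl
bool-ext {false} {false} _ _ = refl

≡ᵇ-refl : ∀ m → (m ≡ᵇ m) ≡ true
≡ᵇ-refl zero    = refl
≡ᵇ-refl (suc m) = ≡ᵇ-refl m

≡ᵇ-sound : ∀ {m n} → (m ≡ᵇ n) ≡ true → m ≡ n
≡ᵇ-sound {m} {n} e = ≡ᵇ⇒≡ m n (Equivalence.from T-≡ e)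

=F-refl : ∀ {m} (x : Fin m) → (x =F x) ≡ true
=F-refl x with x ≟ x
... | yes _  = refl
... | no x≢x = contradiction refl x≢x

=F-sound : ∀ {m} {x y : Fin m} → (x =F y) ≡ true → x ≡ y
=F-sound {x = x} {y} e with x ≟ y
... | yes x≡y = x≡y

≢⇒=F-false : ∀ {m} {x y : Fin m} → x ≢ y → (x =F y) ≡ false
≢⇒=F-false {x = x} {y} x≢y with x ≟ y
... | yes x≡y = contradiction x≡y x≢y
... | no _    = refl

ind : Bool → ℕ
ind b = if b then 1 else 0

allF-sound : ∀ {m} {p : Fin m → Bool} → allF p ≡ true → ∀ i → p i ≡ true
allF-sound {suc m} {p} e zero    = ∧-conicalˡ _ _ e
allF-sound {suc m} {p} e (suc i) = allF-sound (∧-conicalʳ (p zero) _ e) i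

allF-complete : ∀ {m} {p : Fin m → Bool} → (∀ i → p i ≡ true) → allF p ≡ true
allF-complete {zero}  f = refl
allF-complete {suc m} f = ∧-intro (f zero) (allF-complete (λ i → f (suc i)))

anyF-sound : ∀ {m} {p : Fin m → Bool} → anyF p ≡ true → ∃ λ i → p i ≡ true
anyF-sound {suc m} {p} e with p zero in eq
... | true  = zero , eq
... | false with anyF-sound {m} e
...   | i , q = suc i , q

anyF-false : ∀ {m} {p : Fin m → Bool} → (∀ i → p i ≡ false) → anyF p ≡ false
anyF-false {zero}  f = refl
anyF-false {suc m} f rewrite f zero = anyF-false (λ i → f (suc i))

countF-cong : ∀ {m} {p q : Fin m → Bool} → (∀ i → p i ≡ q i) → countF p ≡ countF q
countF-cong {zero}  f = refl
countF-cong {suc m} f = cong₂ _+_ (cong ind (f zero)) (countF-cong (λ i → f (suc i)))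

countF-false : ∀ {m} {p : Fin m → Bool} → (∀ i → p i ≡ false) → countF p ≡ 0
countF-false {zero}  f = refl
countF-false {suc m} f rewrite f zero = countF-false (λ i → f (suc i))

countF-zero⇒false : ∀ {m} {p : Fin m → Bool} → countF p ≡ 0 → ∀ i → p i ≡ false
countF-zero⇒false {suc m} {p} e i with p zero in eq
countF-zero⇒false {suc m} {p} e zero    | false = eq
countF-zero⇒false {suc m} {p} e (suc i) | false = countF-zero⇒false e i

countF-suc⇒witness : ∀ {m c} {p : Fin m → Bool} → countF p ≡ suc c → ∃ λ i → p i ≡ true
countF-suc⇒witness {suc m} {p = p} e with p zero in eq
... | true  = zero , eq
... | false with countF-suc⇒witness {m} e
...   | i , q = suc i , q

countF-+ : ∀ {m} {p q r : Fin m → Bool} → (∀ i → ind (p i) ≡ ind (q i) + ind (r i)) →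
  countF p ≡ countF q + countF r
countF-+ {zero}  e = refl
countF-+ {suc m} {p} {q} {r} e = begin
  ind (p zero) + countF (p ∘ suc)
    ≡⟨ cong₂ _+_ (e zero) (countF-+ (λ i → e (suc i))) ⟩
  (ind (q zero) + ind (r zero)) + (countF (q ∘ suc) + countF (r ∘ suc))
    ≡⟨ +-interchange (ind (q zero)) _ _ _ ⟩
  (ind (q zero) + countF (q ∘ suc)) + (ind (r zero) + countF (r ∘ suc)) ∎
  where open ≡-Reasoning

countF-mono : ∀ {m} {p q : Fin m → Bool} → (∀ i → p i ≡ true → q i ≡ true) → countF p ≤ countF q
countF-mono {zero} f = z≤n
countF-mono {suc m} {p} {q} f with p zero in ep | q zero in eq
... | true  | true  = s≤s (countF-mono (λ i → f (suc i)))
... | true  | false = contradiction (trans (sym (f zero ep)) eq) λ ()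
... | false | true  = m≤n⇒m≤1+n (countF-mono (λ i → f (suc i)))
... | false | false = countF-mono (λ i → f (suc i))

countF-single : ∀ {m} (x : Fin m) (p : Fin m → Bool) → countF (λ i → (i =F x) ∧ p i) ≡ ind (p x)
countF-single {suc m} zero p = begin
  ind (p zero) + countF (λ i → (suc i =F zero) ∧ p (suc i))
    ≡⟨ cong (ind (p zero) +_) (countF-false (λ i → cong (_∧ p (suc i)) (≢⇒=F-false {x = suc i} {zero} λ ()))) ⟩
  ind (p zero) + 0
    ≡⟨ +-identityʳ _ ⟩
  ind (p zero) ∎
  where open ≡-Reasoning
countF-single {suc m} (suc x) p = trans
  (countF-cong (λ i → cong (_∧ p (suc i)) (suc=Fsuc i)))
  (countF-single x (p ∘ suc))
  where
  suc=Fsuc : ∀ i → (suc i =F suc x) ≡ (i =F x)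
  suc=Fsuc i with i ≟ x
  ... | yes refl = refl
  ... | no _     = refl

countF-pair : ∀ {m} (p : Fin m → Bool) (x y : Fin m) → x ≢ y →
  (∀ i → p i ≡ true → i ≡ x ⊎ i ≡ y) → countF p ≡ ind (p x) + ind (p y)
countF-pair p x y x≢y supported = trans
  (countF-+ {q = λ i → (i =F x) ∧ p i} {r = λ i → (i =F y) ∧ p i} split)
  (cong₂ _+_ (countF-single x p) (countF-single y p))
  where
  split : ∀ i → ind (p i) ≡ ind ((i =F x) ∧ p i) + ind ((i =F y) ∧ p i)
  split i with p i in pi
  ... | false rewrite ∧-zeroʳ (i =F x) | ∧-zeroʳ (i =F y) = refl
  ... | true with supported i pi
  ...   | inj₁ refl rewrite =F-refl x | ≢⇒=F-false x≢y = refl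
  ...   | inj₂ refl rewrite =F-refl y | ≢⇒=F-false (x≢y ∘ sym) = refl

two≤countF : ∀ {m} {p : Fin m → Bool} (x y : Fin m) → x ≢ y → p x ≡ true → p y ≡ true → 2 ≤ countF p
two≤countF {p = p} x y x≢y px py = begin
  2                                            ≡⟨ cong₂ (λ a b → ind a + ind b) (∨-introˡ (=F-refl x)) (∨-introʳ (=F-refl y)) ⟨
  ind (x =F x ∨ x =F y) + ind (y =F x ∨ y =F y) ≡⟨ countF-pair pair x y x≢y (λ i → ∨-elim-=F) ⟨
  countF pair                                  ≤⟨ countF-mono in-p ⟩
  countF p                                     ∎
  where
  open ≤-Reasoning
  pair : Fin _ → Bool
  pair i = (i =F x) ∨ (i =F y)
  ∨-elim-=F : ∀ {i} → pair i ≡ true → i ≡ x ⊎ i ≡ y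
  ∨-elim-=F e with ∨-elim e
  ... | inj₁ e′ = inj₁ (=F-sound e′)
  ... | inj₂ e′ = inj₂ (=F-sound e′)
  in-p : ∀ i → pair i ≡ true → p i ≡ true
  in-p i e with ∨-elim-=F {i} e
  ... | inj₁ refl = px
  ... | inj₂ refl = py

countF-splitAt : ∀ V {m} (p : Fin (V + m) → Bool) →
  countF p ≡ countF (λ u → p (u ↑ˡ m)) + countF (λ j → p (V ↑ʳ j))
countF-splitAt zero    p = refl
countF-splitAt (suc V) p = trans (cong (ind (p zero) +_) (countF-splitAt V (p ∘ suc))) (sym (+-assoc (ind (p zero)) _ _))

∑ : {A : Set} → List A → (A → ℕ) → ℕ
∑ []       f = 0
∑ (x ∷ xs) f = f x + ∑ xs f

syntax ∑ xs (λ x → e) = ∑[ x ∈ xs ] e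

∑-cong : {A : Set} (xs : List A) {f g : A → ℕ} → (∀ x → f x ≡ g x) → ∑ xs f ≡ ∑ xs g
∑-cong []       e = refl
∑-cong (x ∷ xs) e = cong₂ _+_ (e x) (∑-cong xs e)

∑-cong-∈ : {A : Set} (xs : List A) {f g : A → ℕ} → (∀ x → x ∈ xs → f x ≡ g x) → ∑ xs f ≡ ∑ xs g
∑-cong-∈ []       e = refl
∑-cong-∈ (x ∷ xs) e = cong₂ _+_ (e x (here refl)) (∑-cong-∈ xs (λ y y∈ → e y (there y∈)))

∑-zero : {A : Set} (xs : List A) → ∑[ x ∈ xs ] 0 ≡ 0
∑-zero []       = refl
∑-zero (x ∷ xs) = ∑-zero xs

∑-+ : {A : Set} (xs : List A) (f g : A → ℕ) → ∑[ x ∈ xs ] (f x + g x) ≡ ∑ xs f + ∑ xs g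
∑-+ []       f g = refl
∑-+ (x ∷ xs) f g = trans (cong (f x + g x +_) (∑-+ xs f g)) (+-interchange (f x) (g x) _ _)

∑-swap : {A B : Set} (xs : List A) (ys : List B) (f : A → B → ℕ) →
  ∑[ x ∈ xs ] ∑ ys (f x) ≡ ∑[ y ∈ ys ] ∑[ x ∈ xs ] f x y
∑-swap []       ys f = sym (∑-zero ys)
∑-swap (x ∷ xs) ys f = trans (cong (∑ ys (f x) +_) (∑-swap xs ys f)) (sym (∑-+ ys (f x) _))

∑-++ : {A : Set} (xs ys : List A) (f : A → ℕ) → ∑ (xs ++ ys) f ≡ ∑ xs f + ∑ ys f
∑-++ []       ys f = refl
∑-++ (x ∷ xs) ys f = trans (cong (f x +_) (∑-++ xs ys f)) (sym (+-assoc (f x) _ _))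

∑-map : {A B : Set} (g : A → B) (xs : List A) (f : B → ℕ) → ∑ (map g xs) f ≡ ∑[ x ∈ xs ] f (g x)
∑-map g []       f = refl
∑-map g (x ∷ xs) f = cong (f (g x) +_) (∑-map g xs f)

∑-concatMap : {A B : Set} (g : A → List B) (xs : List A) (f : B → ℕ) →
  ∑ (concatMap g xs) f ≡ ∑[ x ∈ xs ] ∑ (g x) f
∑-concatMap g []       f = refl
∑-concatMap g (x ∷ xs) f = trans (∑-++ (g x) (concatMap g xs) f) (cong (∑ (g x) f +_) (∑-concatMap g xs f))

∑-ind-∧ : {A : Set} (xs : List A) (b : Bool) (p : A → Bool) →
  ∑[ x ∈ xs ] ind (b ∧ p x) ≡ (if b then ∑[ x ∈ xs ] ind (p x) else 0)
∑-ind-∧ xs true  p = refl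
∑-ind-∧ xs false p = ∑-zero xs

∑-tabulate : ∀ {A : Set} {m} (t : Fin m → A) (p : A → Bool) → ∑[ x ∈ tabulate t ] ind (p x) ≡ countF (p ∘ t)
∑-tabulate {m = zero}  t p = refl
∑-tabulate {m = suc m} t p = cong (ind (p (t zero)) +_) (∑-tabulate (t ∘ suc) p)

length-filterᵇ : {A : Set} (p : A → Bool) (xs : List A) → length (filterᵇ p xs) ≡ ∑[ x ∈ xs ] ind (p x)
length-filterᵇ p []       = refl
length-filterᵇ p (x ∷ xs) with p x
... | true  = cong suc (length-filterᵇ p xs)
... | false = length-filterᵇ p xs

length-filterᵇ-filterᵇ : {A : Set} (p q : A → Bool) (xs : List A) →
  length (filterᵇ q (filterᵇ p xs)) ≡ ∑[ x ∈ xs ] ind (p x ∧ q x)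
length-filterᵇ-filterᵇ p q []       = refl
length-filterᵇ-filterᵇ p q (x ∷ xs) with p x
... | false = length-filterᵇ-filterᵇ p q xs
... | true with q x
...   | true  = cong suc (length-filterᵇ-filterᵇ p q xs)
...   | false = length-filterᵇ-filterᵇ p q xs

-- Edge sets are functions, so a list of them can enumerate only up to a Boolean equivalence.
Enumerates : {A : Set} → (A → A → Bool) → List A → Set
Enumerates _≈_ xs = ∀ x → ∑[ y ∈ xs ] ind (x ≈ y) ≡ 1

pointwiseᵇ : {A : Set} {m : ℕ} → (A → A → Bool) → (Fin m → A) → (Fin m → A) → Bool
pointwiseᵇ _≈_ f g = allF (λ i → f i ≈ g i)

allFuns-enumerates : {A : Set} (_≈_ : A → A → Bool) (xs : List A) → Enumerates _≈_ xs →
  ∀ m → Enumerates (pointwiseᵇ {m = m} _≈_) (allFuns m xs)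
allFuns-enumerates _≈_ xs enum zero    f = refl
allFuns-enumerates _≈_ xs enum (suc m) f = begin
  ∑[ g ∈ allFuns (suc m) xs ] ind (pointwiseᵇ _≈_ f g)
    ≡⟨ trans (∑-concatMap _ xs _) (∑-cong xs (λ a → ∑-map _ (allFuns m xs) _)) ⟩
  ∑[ a ∈ xs ] ∑[ g ∈ allFuns m xs ] ind ((f zero ≈ a) ∧ pointwiseᵇ _≈_ (f ∘ suc) g)
    ≡⟨ ∑-cong xs (λ a → ∑-ind-∧ (allFuns m xs) (f zero ≈ a) _) ⟩
  ∑[ a ∈ xs ] (if f zero ≈ a then ∑[ g ∈ allFuns m xs ] ind (pointwiseᵇ _≈_ (f ∘ suc) g) else 0)
    ≡⟨ ∑-cong xs (λ a → cong (if f zero ≈ a then_else 0) (allFuns-enumerates _≈_ xs enum m (f ∘ suc))) ⟩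
  ∑[ a ∈ xs ] ind (f zero ≈ a)
    ≡⟨ enum (f zero) ⟩
  1 ∎
  where open ≡-Reasoning

∑-ind-bijection : {A B : Set} (_≈ᴬ_ : A → A → Bool) (_≈ᴮ_ : B → B → Bool) (xs : List A) (ys : List B) →
  Enumerates _≈ᴬ_ xs → Enumerates _≈ᴮ_ ys →
  (P : A → Bool) (Q : B → Bool) (f : A → B) (g : B → A) →
  (∀ a b → P a ≡ true → (f a ≈ᴮ b) ≡ true → Q b ≡ true × (g b ≈ᴬ a) ≡ true) →
  (∀ a b → Q b ≡ true → (g b ≈ᴬ a) ≡ true → P a ≡ true × (f a ≈ᴮ b) ≡ true) →
  ∑[ a ∈ xs ] ind (P a) ≡ ∑[ b ∈ ys ] ind (Q b)
∑-ind-bijection _≈ᴬ_ _≈ᴮ_ xs ys enumA enumB P Q f g fwd bwd = begin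
  ∑[ a ∈ xs ] ind (P a)                           ≡⟨ ∑-cong xs (λ a → sym (fibre _≈ᴮ_ ys enumB (P a) (f a))) ⟩
  ∑[ a ∈ xs ] ∑[ b ∈ ys ] ind (P a ∧ (f a ≈ᴮ b))  ≡⟨ ∑-swap xs ys _ ⟩
  ∑[ b ∈ ys ] ∑[ a ∈ xs ] ind (P a ∧ (f a ≈ᴮ b))  ≡⟨ ∑-cong ys (λ b → ∑-cong xs (λ a → cong ind (graph-sym a b))) ⟩
  ∑[ b ∈ ys ] ∑[ a ∈ xs ] ind (Q b ∧ (g b ≈ᴬ a))  ≡⟨ ∑-cong ys (λ b → fibre _≈ᴬ_ xs enumA (Q b) (g b)) ⟩
  ∑[ b ∈ ys ] ind (Q b)                           ∎
  where
  open ≡-Reasoning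
  fibre : {C : Set} (_≈_ : C → C → Bool) (zs : List C) → Enumerates _≈_ zs →
    ∀ c z → ∑[ z' ∈ zs ] ind (c ∧ (z ≈ z')) ≡ ind c
  fibre _≈_ zs enum c z = trans (∑-ind-∧ zs c _) (cong (if c then_else 0) (enum z))
  graph-sym : ∀ a b → (P a ∧ (f a ≈ᴮ b)) ≡ (Q b ∧ (g b ≈ᴬ a))
  graph-sym a b = bool-ext
    (λ e → let q , r = fwd a b (∧-conicalˡ _ _ e) (∧-conicalʳ (P a) _ e) in ∧-intro q r)
    (λ e → let p , r = bwd a b (∧-conicalˡ _ _ e) (∧-conicalʳ (Q b) _ e) in ∧-intro p r)

EdgeSet : ℕ → Set
EdgeSet V = Fin V → Fin V → Bool

_≐_ : ∀ {V} → EdgeSet V → EdgeSet V → Set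
M ≐ M' = ∀ u v → M u v ≡ M' u v

_≐ᵇ_ : ∀ {V} → EdgeSet V → EdgeSet V → Bool
_≐ᵇ_ = pointwiseᵇ (pointwiseᵇ _==ᵇ_)

≐ᵇ-sound : ∀ {V} {M M' : EdgeSet V} → (M ≐ᵇ M') ≡ true → M ≐ M'
≐ᵇ-sound e u v = ==ᵇ⇒≡ (allF-sound (allF-sound e u) v)

≐ᵇ-complete : ∀ {V} {M M' : EdgeSet V} → M ≐ M' → (M ≐ᵇ M') ≡ true
≐ᵇ-complete {M = M} e =
  allF-complete (λ u → allF-complete (λ v → subst (λ z → (M u v ==ᵇ z) ≡ true) (e u v) (==ᵇ-refl (M u v))))

edgeSets : (V : ℕ) → List (EdgeSet V)
edgeSets V = allFuns V (allFuns V (true ∷ false ∷ []))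

edgeSets-enumerates : ∀ V → Enumerates _≐ᵇ_ (edgeSets V)
edgeSets-enumerates V =
  allFuns-enumerates _ _ (allFuns-enumerates _==ᵇ_ _ bools-enumerate V) V
  where
  bools-enumerate : Enumerates _==ᵇ_ (true ∷ false ∷ [])
  bools-enumerate true  = refl
  bools-enumerate false = refl

record IsKekule (G : Graph) (M : EdgeSet (Graph.V G)) : Set where
  field
    ⊆-edges   : ∀ u v → M u v ≡ true → Graph.adj G u v ≡ true
    symmetric : ∀ u v → M u v ≡ M v u
    covers    : ∀ v → Graph.vert G v ≡ true → countF (M v) ≡ 1

IsKekuleᵇ-sound : (G : Graph) (M : EdgeSet (Graph.V G)) → IsKekuleᵇ G M ≡ true → IsKekule G M
IsKekuleᵇ-sound G M e = record
  { ⊆-edges   = λ u v → ⇒ᵇ-elim (∧-conicalˡ _ _ (local u v))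
  ; symmetric = λ u v → ==ᵇ⇒≡ (∧-conicalʳ (M u v ⇒ᵇ Graph.adj G u v) _ (local u v))
  ; covers    = λ v → ≡ᵇ-sound ∘ ⇒ᵇ-elim (allF-sound (∧-conicalʳ _ _ e) v) }
  where
  local : ∀ u v → ((M u v ⇒ᵇ Graph.adj G u v) ∧ (M u v ==ᵇ M v u)) ≡ true
  local u v = allF-sound (allF-sound (∧-conicalˡ _ _ e) u) v

IsKekuleᵇ-complete : (G : Graph) (M : EdgeSet (Graph.V G)) → IsKekule G M → IsKekuleᵇ G M ≡ true
IsKekuleᵇ-complete G M k =
  ∧-intro (allF-complete λ u → allF-complete λ v → ∧-intro (inside-edges u v) (symmetric′ u v))
          (allF-complete covers′)
  where
  open IsKekule k
  inside-edges : ∀ u v → (M u v ⇒ᵇ Graph.adj G u v) ≡ true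
  inside-edges u v with M u v in e
  ... | false = refl
  ... | true  = ⊆-edges u v e
  symmetric′ : ∀ u v → (M u v ==ᵇ M v u) ≡ true
  symmetric′ u v rewrite symmetric u v = ==ᵇ-refl (M v u)
  covers′ : ∀ v → (Graph.vert G v ⇒ᵇ (countF (M v) ≡ᵇ 1)) ≡ true
  covers′ v with Graph.vert G v in e
  ... | false = refl
  ... | true rewrite covers v e = refl

IsKekule-resp : (G : Graph) {M M' : EdgeSet (Graph.V G)} → M ≐ M' → IsKekule G M → IsKekule G M'
IsKekule-resp G e k = record
  { ⊆-edges   = λ u v m → ⊆-edges u v (trans (e u v) m)
  ; symmetric = λ u v → trans (sym (e u v)) (trans (symmetric u v) (e v u))
  ; covers    = λ v vv → trans (countF-cong (λ u → sym (e v u))) (covers v vv) }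
  where open IsKekule k

kekuleCount : (G : Graph) → (EdgeSet (Graph.V G) → Bool) → ℕ
kekuleCount G P = ∑[ M ∈ edgeSets (Graph.V G) ] ind (IsKekuleᵇ G M ∧ P M)

numKekule-kekuleCount : (G : Graph) → numKekule G ≡ kekuleCount G (λ _ → true)
numKekule-kekuleCount G = trans (length-filterᵇ (IsKekuleᵇ G) (edgeSets (Graph.V G)))
  (∑-cong (edgeSets (Graph.V G)) (λ M → cong ind (sym (∧-identityʳ (IsKekuleᵇ G M)))))

numKekuleContaining-kekuleCount : (G : Graph) (u v : Fin (Graph.V G)) →
  numKekuleContaining G u v ≡ kekuleCount G (λ M → M u v)
numKekuleContaining-kekuleCount G u v =
  length-filterᵇ-filterᵇ (IsKekuleᵇ G) (λ M → M u v) (edgeSets (Graph.V G))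

kekuleCount-const : (G : Graph) (c : Bool) → kekuleCount G (λ _ → c) ≡ (if c then numKekule G else 0)
kekuleCount-const G true  = sym (numKekule-kekuleCount G)
kekuleCount-const G false =
  trans (∑-cong (edgeSets (Graph.V G)) (λ M → cong ind (∧-zeroʳ (IsKekuleᵇ G M)))) (∑-zero (edgeSets (Graph.V G)))

kekuleCount-never : (G : Graph) (P : EdgeSet (Graph.V G) → Bool) →
  (∀ M → IsKekule G M → P M ≡ false) → kekuleCount G P ≡ 0
kekuleCount-never G P never = trans (∑-cong (edgeSets (Graph.V G)) vanish) (∑-zero (edgeSets (Graph.V G)))
  where
  vanish : ∀ M → ind (IsKekuleᵇ G M ∧ P M) ≡ 0
  vanish M with IsKekuleᵇ G M in kek
  ... | false = refl
  ... | true  = cong ind (never M (IsKekuleᵇ-sound G M kek))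

kekuleCount-split : (G : Graph) (f P : EdgeSet (Graph.V G) → Bool) →
  kekuleCount G P ≡ kekuleCount G (λ M → (f M ==ᵇ true) ∧ P M) + kekuleCount G (λ M → (f M ==ᵇ false) ∧ P M)
kekuleCount-split G f P =
  trans (∑-cong (edgeSets (Graph.V G)) (λ M → by-value (IsKekuleᵇ G M) (f M) (P M))) (∑-+ (edgeSets (Graph.V G)) _ _)
  where
  by-value : ∀ x c y → ind (x ∧ y) ≡ ind (x ∧ ((c ==ᵇ true) ∧ y)) + ind (x ∧ ((c ==ᵇ false) ∧ y))
  by-value false c     y = refl
  by-value true  true  y = sym (+-identityʳ _)
  by-value true  false y = refl

record KekuleCorrespondence (G G' : Graph) (selected : EdgeSet (Graph.V G') → Bool) : Set where
  field
    extend   : EdgeSet (Graph.V G) → EdgeSet (Graph.V G')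
    restrict : EdgeSet (Graph.V G') → EdgeSet (Graph.V G)
    extend-cong     : ∀ {M M'} → M ≐ M' → extend M ≐ extend M'
    restrict-cong   : ∀ {M M'} → M ≐ M' → restrict M ≐ restrict M'
    selected-cong   : ∀ {M M'} → M ≐ M' → selected M ≡ selected M'
    extend-kekule   : ∀ M → IsKekule G M → IsKekule G' (extend M)
    extend-selected : ∀ M → IsKekule G M → selected (extend M) ≡ true
    restrict-kekule : ∀ M → IsKekule G' M → selected M ≡ true → IsKekule G (restrict M)
    restrict-extend : ∀ M → restrict (extend M) ≐ M
    extend-restrict : ∀ M → IsKekule G' M → selected M ≡ true → extend (restrict M) ≐ M

module _ {G G' : Graph} {selected : EdgeSet (Graph.V G') → Bool}
         (corr : KekuleCorrespondence G G' selected) where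
  open KekuleCorrespondence corr

  kekuleCount-correspondence :
    (P' : EdgeSet (Graph.V G') → Bool) (P : EdgeSet (Graph.V G) → Bool) →
    (∀ {M M'} → M ≐ M' → P' M ≡ P' M') → (∀ {M M'} → M ≐ M' → P M ≡ P M') →
    (∀ M → IsKekule G M → P' (extend M) ≡ P M) →
    kekuleCount G' (λ M → selected M ∧ P' M) ≡ kekuleCount G P
  kekuleCount-correspondence P' P P'-cong P-cong P'-extend =
    ∑-ind-bijection _≐ᵇ_ _≐ᵇ_ (edgeSets (Graph.V G')) (edgeSets (Graph.V G))
      (edgeSets-enumerates _) (edgeSets-enumerates _) _ _ restrict extend fwd bwd
    where
    fwd : ∀ M' M → (IsKekuleᵇ G' M' ∧ (selected M' ∧ P' M')) ≡ true → (restrict M' ≐ᵇ M) ≡ true →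
      (IsKekuleᵇ G M ∧ P M) ≡ true × (extend M ≐ᵇ M') ≡ true
    fwd M' M h e = ∧-intro (IsKekuleᵇ-complete G M kek) PM , ≐ᵇ-complete extM≐M'
      where
      kek' = IsKekuleᵇ-sound G' M' (∧-conicalˡ _ _ h)
      sel  = ∧-conicalˡ _ _ (∧-conicalʳ (IsKekuleᵇ G' M') _ h)
      P'M' = ∧-conicalʳ (selected M') _ (∧-conicalʳ (IsKekuleᵇ G' M') _ h)
      res≐M = ≐ᵇ-sound e
      kek = IsKekule-resp G res≐M (restrict-kekule M' kek' sel)
      extM≐M' : extend M ≐ M'
      extM≐M' u v = trans (sym (extend-cong res≐M u v)) (extend-restrict M' kek' sel u v)
      PM = begin
        P M                    ≡⟨ sym (P'-extend M kek) ⟩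
        P' (extend M)          ≡⟨ P'-cong extM≐M' ⟩
        P' M'                  ≡⟨ P'M' ⟩
        true                   ∎
        where open ≡-Reasoning
    bwd : ∀ M' M → (IsKekuleᵇ G M ∧ P M) ≡ true → (extend M ≐ᵇ M') ≡ true →
      (IsKekuleᵇ G' M' ∧ (selected M' ∧ P' M')) ≡ true × (restrict M' ≐ᵇ M) ≡ true
    bwd M' M h e = ∧-intro (IsKekuleᵇ-complete G' M' kek') (∧-intro sel P'M') , ≐ᵇ-complete resM'≐M
      where
      kek = IsKekuleᵇ-sound G M (∧-conicalˡ _ _ h)
      ext≐M' = ≐ᵇ-sound e
      kek' = IsKekule-resp G' ext≐M' (extend-kekule M kek)
      sel = trans (sym (selected-cong ext≐M')) (extend-selected M kek)
      P'M' = trans (sym (P'-cong ext≐M')) (trans (P'-extend M kek) (∧-conicalʳ (IsKekuleᵇ G M) _ h))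
      resM'≐M : restrict M' ≐ M
      resM'≐M u v = trans (sym (restrict-cong ext≐M' u v)) (restrict-extend M u v)

paulingAux-cross : ∀ c K c' K' → 0 < K → 0 < K' → c * K' ≡ c' * K → paulingAux c K ≡ paulingAux c' K'
paulingAux-cross c (suc K) c' (suc K') _ _ e = fromℚᵘ-cong {mkℚᵘ (ℤ+ c) K} {mkℚᵘ (ℤ+ c') K'} (*≡* (begin
  ℤ+ c ℤ.* ℤ+ suc K'   ≡⟨ ℤ.pos-* c (suc K') ⟨
  ℤ+ (c * suc K')      ≡⟨ cong ℤ+_ e ⟩
  ℤ+ (c' * suc K)      ≡⟨ ℤ.pos-* c' (suc K) ⟩
  ℤ+ c' ℤ.* ℤ+ suc K   ∎))
  where open ≡-Reasoning

pauling-zero : ∀ H u v → 0 < numKekule H → numKekuleContaining H u v ≡ 0 → pauling H u v ≡ 0ℚ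
pauling-zero H u v K>0 c≡0 = trans
  (paulingAux-cross _ _ 0 1 K>0 (s≤s z≤n) (cong (_* 1) c≡0))
  (fromℚᵘ-toℚᵘ 0ℚ)

pauling-half : ∀ H u v → 0 < numKekule H → numKekuleContaining H u v * 2 ≡ numKekule H → pauling H u v ≡ ½
pauling-half H u v K>0 2c≡K =
  paulingAux-cross _ _ 1 2 K>0 (s≤s z≤n) (trans 2c≡K (sym (*-identityˡ (numKekule H))))

pauling-cross : ∀ H u v H' u' v' → 0 < numKekule H → 0 < numKekule H' →
  numKekuleContaining H u v * numKekule H' ≡ numKekuleContaining H' u' v' * numKekule H →
  pauling H u v ≡ pauling H' u' v'
pauling-cross H u v H' u' v' = paulingAux-cross _ _ _ _

≢⇒≡ᵇ-false : ∀ {m n} → m ≢ n → (m ≡ᵇ n) ≡ false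
≢⇒≡ᵇ-false {m} {n} m≢n with m ≡ᵇ n in e
... | false = refl
... | true  = contradiction (≡ᵇ-sound e) m≢n

isEven : ℕ → Bool
isEven zero    = true
isEven (suc n) = not (isEven n)

isEven-double : ∀ p → isEven (2 * p) ≡ true
isEven-double zero    = refl
isEven-double (suc p) rewrite +-suc p (p + 0) = trans (not-involutive _) (isEven-double p)

cycPrev : ℕ → ℕ → ℕ
cycPrev m zero    = pred m
cycPrev m (suc t) = t

cycNext : ℕ → ℕ → ℕ
cycNext m t = if suc t ≡ᵇ m then 0 else suc t

cycAdj : ℕ → ℕ → ℕ → Bool
cycAdj m t t' = (suc t ≡ᵇ t') ∨ (suc t' ≡ᵇ t) ∨ ((t ≡ᵇ 0) ∧ (suc t' ≡ᵇ m)) ∨ ((t' ≡ᵇ 0) ∧ (suc t ≡ᵇ m))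

cycNext-suc : ∀ {m t} → suc t < m → cycNext m t ≡ suc t
cycNext-suc {m} {t} lt rewrite ≢⇒≡ᵇ-false {suc t} {m} (λ e → <-irrefl e lt) = refl

cycNext-last : ∀ {m t} → suc t ≡ m → cycNext m t ≡ 0
cycNext-last {m} refl rewrite ≡ᵇ-refl m = refl

cycNext<m : ∀ {m t} → t < m → cycNext m t < m
cycNext<m {m} {t} lt with m≤n⇒m<n∨m≡n lt
... | inj₁ st<m  rewrite cycNext-suc st<m  = st<m
... | inj₂ st≡m rewrite cycNext-last st≡m = ≤-trans (s≤s z≤n) lt

cycPrev<m : ∀ {m t} → t < m → cycPrev m t < m
cycPrev<m {suc m} {zero}  lt = ≤-refl
cycPrev<m {m}     {suc t} lt = ≤-trans (n≤1+n (suc t)) lt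

cycNext-cycPrev : ∀ {m t} → t < m → cycNext m (cycPrev m t) ≡ t
cycNext-cycPrev {suc m} {zero}  lt = cycNext-last refl
cycNext-cycPrev {m}     {suc t} lt = cycNext-suc lt

cycNext-cycNext≢ : ∀ {m t} → t < m → 3 ≤ m → cycNext m (cycNext m t) ≢ t
cycNext-cycNext≢ {m} {t} lt m≥3 with m≤n⇒m<n∨m≡n lt
... | inj₂ st≡m rewrite cycNext-last st≡m | cycNext-suc {m} {0} (≤-trans (s≤s (s≤s z≤n)) m≥3) =
  λ 1≡t → <-irrefl refl (≤-trans m≥3 (≤-reflexive (trans (sym st≡m) (cong suc (sym 1≡t)))))
... | inj₁ st<m rewrite cycNext-suc st<m with m≤n⇒m<n∨m≡n st<m
...   | inj₁ sst<m  rewrite cycNext-suc sst<m = λ e → <-irrefl (sym e) (n≤1+n _)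
...   | inj₂ sst≡m rewrite cycNext-last sst≡m =
  λ 0≡t → <-irrefl refl (≤-trans m≥3 (≤-reflexive (trans (sym sst≡m) (cong (λ z → suc (suc z)) (sym 0≡t)))))

cycPrev≢cycNext : ∀ {m t} → t < m → 3 ≤ m → cycPrev m t ≢ cycNext m t
cycPrev≢cycNext {m} {t} lt m≥3 e = cycNext-cycNext≢ (cycPrev<m lt) m≥3 (begin
  cycNext m (cycNext m (cycPrev m t)) ≡⟨ cong (cycNext m) (cycNext-cycPrev lt) ⟩
  cycNext m t                         ≡⟨ sym e ⟩
  cycPrev m t                         ∎)
  where open ≡-Reasoning

cycAdj-sound : ∀ {m t t'} → t < m → t' < m → cycAdj m t t' ≡ true → t' ≡ cycNext m t ⊎ t' ≡ cycPrev m t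
cycAdj-sound {m} {t} {t'} lt lt' e with ∨-elim e
... | inj₁ e₁ with ≡ᵇ-sound {suc t} {t'} e₁
...   | refl = inj₁ (sym (cycNext-suc lt'))
cycAdj-sound {m} {t} {t'} lt lt' e | inj₂ e₂ with ∨-elim e₂
... | inj₁ e₃ with ≡ᵇ-sound {suc t'} {t} e₃
...   | refl = inj₂ refl
cycAdj-sound {m} {t} {t'} lt lt' e | inj₂ e₂ | inj₂ e₄ with ∨-elim e₄
... | inj₁ e₅ with ≡ᵇ-sound {t} {0} (∧-conicalˡ _ _ e₅) | ≡ᵇ-sound {suc t'} {m} (∧-conicalʳ (t ≡ᵇ 0) _ e₅)
...   | refl | refl = inj₂ refl
cycAdj-sound {m} {t} {t'} lt lt' e | inj₂ e₂ | inj₂ e₄ | inj₂ e₆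
  with ≡ᵇ-sound {t'} {0} (∧-conicalˡ _ _ e₆) | ≡ᵇ-sound {suc t} {m} (∧-conicalʳ (t' ≡ᵇ 0) _ e₆)
... | refl | st≡m = inj₁ (sym (cycNext-last st≡m))

cycAdj-cycNext : ∀ {m t} → t < m → cycAdj m t (cycNext m t) ≡ true
cycAdj-cycNext {m} {t} lt with m≤n⇒m<n∨m≡n lt
... | inj₁ st<m  rewrite cycNext-suc st<m = ∨-introˡ (≡ᵇ-refl (suc t))
... | inj₂ refl rewrite cycNext-last {suc t} {t} refl =
  ∨-introʳ {suc t ≡ᵇ 0} (∨-introʳ {1 ≡ᵇ t} (∨-introʳ {(t ≡ᵇ 0) ∧ (1 ≡ᵇ suc t)} (≡ᵇ-refl t)))

cycAdj-cycPrev : ∀ {m t} → t < m → cycAdj m t (cycPrev m t) ≡ true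
cycAdj-cycPrev {suc m} {zero}  lt = ∨-introʳ {1 ≡ᵇ m} (∨-introʳ {suc m ≡ᵇ 0} (∨-introˡ (≡ᵇ-refl m)))
cycAdj-cycPrev {m}     {suc t} lt = ∨-introʳ {suc (suc t) ≡ᵇ t} (∨-introˡ (≡ᵇ-refl t))

cycAdj-sym : ∀ m t t' → cycAdj m t t' ≡ cycAdj m t' t
cycAdj-sym m t t' = swap (suc t ≡ᵇ t') (suc t' ≡ᵇ t) ((t ≡ᵇ 0) ∧ (suc t' ≡ᵇ m)) ((t' ≡ᵇ 0) ∧ (suc t ≡ᵇ m))
  where
  swap : ∀ a b c d → (a ∨ b ∨ c ∨ d) ≡ (b ∨ a ∨ d ∨ c)
  swap true  true  c d = refl
  swap true  false c d = refl
  swap false true  c d = refl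
  swap false false c d = ∨-comm c d

isEven-cycPrev : ∀ {m t} → isEven m ≡ true → t < m → isEven (cycPrev m t) ≡ not (isEven t)
isEven-cycPrev {suc m} {zero}  e lt = trans (sym (not-involutive (isEven m))) (cong not e)
isEven-cycPrev {m}     {suc t} e lt = sym (not-involutive (isEven t))

one-of-three-right : ∀ a x y → a + (ind x + ind y) ≡ 1 → y ≡ true → a ≡ 0 × x ≡ false
one-of-three-right a x y e refl = go x (trans (+-comm (ind x + 1) a) e)
  where
  go : ∀ x → ind x + 1 + a ≡ 1 → a ≡ 0 × x ≡ false
  go false e = suc-injective e , refl
  go true  ()

one-of-three-middle : ∀ a x y → a + (ind x + ind y) ≡ 1 → x ≡ true → a ≡ 0
one-of-three-middle a x y e refl = go y (trans (+-comm (1 + ind y) a) e)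
  where
  go : ∀ y → 1 + ind y + a ≡ 1 → a ≡ 0
  go false e = suc-injective e
  go true  ()

one-of-three-forced : ∀ a x y → a + (ind x + ind y) ≡ 1 → a ≡ 0 → y ≡ false → x ≡ true
one-of-three-forced .0 true  .false e refl refl = refl
one-of-three-forced .0 false .false () refl refl

-- Perfect matchings of an even cycle with pendant edges

-- used t: the cycle edge from t to t + 1 (mod m) is matched; spokes t: matched pendant edges at t.
module AlternatingCycle (m : ℕ) (m-even : isEven m ≡ true) (m≥1 : 1 ≤ m)
  (spokes : ℕ → ℕ) (used : ℕ → Bool)
  (covered : ∀ t → t < m → spokes t + (ind (used t) + ind (used (cycPrev m t))) ≡ 1)
  (odd-no-spoke : ∀ t → t < m → isEven t ≡ false → spokes t ≡ 0) where

  propagate : ∀ t → isEven t ≡ true → used t ≡ false → ∀ k → t + k < m →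
    used (t + k) ≡ not (isEven (t + k)) × (0 < k → spokes (t + k) ≡ 0)
  propagate t even unused zero lt rewrite +-identityʳ t | even = unused , λ ()
  propagate t even unused (suc k) lt rewrite +-suc t k
    with propagate t even unused k (≤-trans (n≤1+n _) lt)
  ... | previous , _ with isEven (t + k) in parity
  ...   | true =
    one-of-three-forced _ _ _ (covered (suc (t + k)) lt) no-spoke previous , λ _ → no-spoke
    where no-spoke = odd-no-spoke (suc (t + k)) lt (cong not parity)
  ...   | false =
    let no-spoke , unused′ = one-of-three-right _ _ _ (covered (suc (t + k)) lt) previous
    in unused′ , λ _ → no-spoke

  isEven-last : isEven (pred m) ≡ false
  isEven-last = go m≥1 m-even
    where
    go : ∀ {n} → 1 ≤ n → isEven n ≡ true → isEven (pred n) ≡ false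
    go {suc n} _ e = trans (sym (not-involutive (isEven n))) (cong not e)

  -- The pattern forced from t runs up to the odd position m ∸ 1, whose used edge then blocks 0.
  wrap-around : ∀ t → t < m → isEven t ≡ true → used t ≡ false → used 0 ≡ false × spokes 0 ≡ 0
  wrap-around t lt even unused =
    let used-last = trans (subst (λ z → used z ≡ not (isEven z)) t+k≡last (proj₁ reach)) (cong not isEven-last)
        no-spoke , unused₀ = one-of-three-right _ _ _ (covered 0 m≥1) used-last
    in unused₀ , no-spoke
    where
    t≤last : t ≤ pred m
    t≤last = pred-mono-≤ lt
    t+k≡last : t + (pred m ∸ t) ≡ pred m
    t+k≡last = m+[n∸m]≡n t≤last
    reach = propagate t even unused (pred m ∸ t)
      (subst (_< m) (sym t+k≡last) (≤-reflexive (suc-pred m {{>-nonZero m≥1}})))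

  no-spokes-and-alternates : ∀ t → t < m → spokes t ≡ 0 × used t ≡ (isEven t ==ᵇ used 0)
  no-spokes-and-alternates t lt with used 0 in used₀
  no-spokes-and-alternates zero    lt | false = proj₂ (wrap-around 0 m≥1 refl used₀) , used₀
  no-spokes-and-alternates (suc t) lt | false =
    let used-t , no-spoke = propagate 0 refl used₀ (suc t) lt
    in no-spoke (s≤s z≤n) , trans used-t (sym (==ᵇ-false (isEven (suc t))))
  no-spokes-and-alternates t lt | true with isEven t in even | used t in used-t
  ... | true | false = contradiction (trans (sym used₀) (proj₁ (wrap-around t lt even used-t))) λ ()
  ... | true | true  = one-of-three-middle _ _ _ (covered t lt) used-t , refl
  ... | false | _ with used (cycPrev m t) in used-prev
  ...   | false = contradiction
          (trans (sym used₀) (proj₁ (wrap-around (cycPrev m t) (cycPrev<m lt)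
            (trans (isEven-cycPrev m-even lt) (cong not even)) used-prev))) λ ()
  ...   | true = let no-spoke , unused = one-of-three-right _ _ _ (covered t lt) used-prev
                 in no-spoke , trans (sym used-t) unused

-- One altan step

Deg2Rich : (G : Graph) (k : ℕ) → (Fin k → List (Fin (Graph.V G))) → Set
Deg2Rich G k C = ∀ i → 2 ≤ length (deg2On G (C i))

Deg2Disjoint : (G : Graph) (k : ℕ) → (Fin k → List (Fin (Graph.V G))) → Set
Deg2Disjoint G k C = ∀ i j v → v ∈ C i → v ∈ C j → Graph.vert G v ≡ true → deg G v ≡ 2 → i ≡ j

module OneAltan {n k : ℕ} (s : AState n k) (i : Fin k) (two-deg2 : 2 ≤ AltanStep.d s i) where
  open AState s
  open AltanStep s i

  G G' : Graph
  G  = graphOf s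
  G' = graphOf result

  m : ℕ
  m = 2 * d

  m-even : isEven m ≡ true
  m-even = isEven-double d

  m≥4 : 4 ≤ m
  m≥4 = *-monoʳ-≤ 2 two-deg2

  m≥3 : 3 ≤ m
  m≥3 = ≤-trans (n≤1+n 3) m≥4

  m≥1 : 1 ≤ m
  m≥1 = ≤-trans (s≤s z≤n) m≥3

  old : Fin V → Fin (V + m)
  old u = u ↑ˡ m

  new : Fin m → Fin (V + m)
  new j = V ↑ʳ j

  old-or-new : ∀ x → (Σ (Fin V) λ u → x ≡ old u) ⊎ (Σ (Fin m) λ j → x ≡ new j)
  old-or-new x with splitAt V x in e
  ... | inj₁ u = inj₁ (u , sym (splitAt⁻¹-↑ˡ e))
  ... | inj₂ j = inj₂ (j , sym (splitAt⁻¹-↑ʳ e))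

  adj'-old : ∀ u v → adj' (old u) (old v) ≡ adj u v
  adj'-old u v rewrite splitAt-↑ˡ V u m | splitAt-↑ˡ V v m = refl
  adj'-old-new : ∀ u j → adj' (old u) (new j) ≡ spoke u j
  adj'-old-new u j rewrite splitAt-↑ˡ V u m | splitAt-↑ʳ V m j = refl
  adj'-new-old : ∀ j u → adj' (new j) (old u) ≡ spoke u j
  adj'-new-old j u rewrite splitAt-↑ˡ V u m | splitAt-↑ʳ V m j = refl
  adj'-new : ∀ j j' → adj' (new j) (new j') ≡ newAdj j j'
  adj'-new j j' rewrite splitAt-↑ʳ V m j | splitAt-↑ʳ V m j' = refl

  spk'-old : ∀ u v → spk' (old u) (old v) ≡ spk u v
  spk'-old u v rewrite splitAt-↑ˡ V u m | splitAt-↑ˡ V v m = refl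
  spk'-old-new : ∀ u j → spk' (old u) (new j) ≡ spoke u j
  spk'-old-new u j rewrite splitAt-↑ˡ V u m | splitAt-↑ʳ V m j = refl
  spk'-new-old : ∀ j u → spk' (new j) (old u) ≡ spoke u j
  spk'-new-old j u rewrite splitAt-↑ˡ V u m | splitAt-↑ʳ V m j = refl
  spk'-new : ∀ j j' → spk' (new j) (new j') ≡ false
  spk'-new j j' rewrite splitAt-↑ʳ V m j | splitAt-↑ʳ V m j' = refl

  vert'-old : ∀ u → vert' (old u) ≡ vert u
  vert'-old u rewrite splitAt-↑ˡ V u m = refl
  vert'-new : ∀ j → vert' (new j) ≡ true
  vert'-new j rewrite splitAt-↑ʳ V m j = refl

  -- Positions t ≥ m are sent to the junk vertex 0.
  ringVertex : ℕ → Fin m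
  ringVertex t with t <? m
  ... | yes t<m = fromℕ< t<m
  ... | no _    = fromℕ< m≥1

  toℕ-ringVertex : ∀ {t} → t < m → toℕ (ringVertex t) ≡ t
  toℕ-ringVertex {t} t<m with t <? m
  ... | yes _   = toℕ-fromℕ< _
  ... | no t≮m = contradiction t<m t≮m

  ringVertex-toℕ : ∀ j → ringVertex (toℕ j) ≡ j
  ringVertex-toℕ j = toℕ-injective (toℕ-ringVertex (toℕ<n j))

  next prev : Fin m → Fin m
  next j = ringVertex (cycNext m (toℕ j))
  prev j = ringVertex (cycPrev m (toℕ j))

  toℕ-next : ∀ j → toℕ (next j) ≡ cycNext m (toℕ j)
  toℕ-next j = toℕ-ringVertex (cycNext<m (toℕ<n j))

  toℕ-prev : ∀ j → toℕ (prev j) ≡ cycPrev m (toℕ j)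
  toℕ-prev j = toℕ-ringVertex (cycPrev<m (toℕ<n j))

  next-prev : ∀ j → next (prev j) ≡ j
  next-prev j = begin
    ringVertex (cycNext m (toℕ (prev j)))  ≡⟨ cong (ringVertex ∘ cycNext m) (toℕ-prev j) ⟩
    ringVertex (cycNext m (cycPrev m (toℕ j))) ≡⟨ cong ringVertex (cycNext-cycPrev (toℕ<n j)) ⟩
    ringVertex (toℕ j)                      ≡⟨ ringVertex-toℕ j ⟩
    j                                       ∎
    where open ≡-Reasoning

  next≢prev : ∀ j → next j ≢ prev j
  next≢prev j e = cycPrev≢cycNext (toℕ<n j) m≥3
    (trans (sym (toℕ-prev j)) (trans (cong toℕ (sym e)) (toℕ-next j)))

  newAdj-sound : ∀ j j' → newAdj j j' ≡ true → j' ≡ next j ⊎ j' ≡ prev j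
  newAdj-sound j j' e with cycAdj-sound (toℕ<n j) (toℕ<n j') e
  ... | inj₁ e′ = inj₁ (trans (sym (ringVertex-toℕ j')) (cong ringVertex e′))
  ... | inj₂ e′ = inj₂ (trans (sym (ringVertex-toℕ j')) (cong ringVertex e′))

  newAdj-next : ∀ j → newAdj j (next j) ≡ true
  newAdj-next j = subst (λ z → cycAdj m (toℕ j) z ≡ true) (sym (toℕ-next j)) (cycAdj-cycNext (toℕ<n j))

  newAdj-prev : ∀ j → newAdj j (prev j) ≡ true
  newAdj-prev j = subst (λ z → cycAdj m (toℕ j) z ≡ true) (sym (toℕ-prev j)) (cycAdj-cycPrev (toℕ<n j))

  newAdj-sym : ∀ j j' → newAdj j j' ≡ newAdj j' j
  newAdj-sym j j' = cycAdj-sym m (toℕ j) (toℕ j')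

  newAdj-count : ∀ j → countF (newAdj j) ≡ 2
  newAdj-count j = trans (countF-pair (newAdj j) (next j) (prev j) (next≢prev j) (newAdj-sound j))
    (cong₂ (λ x y → ind x + ind y) (newAdj-next j) (newAdj-prev j))

  -- New vertex 2p is w_{p+1} and 2p + 1 is x_{p+1}: b = true takes the edges w x, b = false the edges x w.
  alternating : Bool → EdgeSet m
  alternating b j j' = ((toℕ j' ≡ᵇ cycNext m (toℕ j)) ∧ (isEven (toℕ j) ==ᵇ b))
                     ∨ ((toℕ j ≡ᵇ cycNext m (toℕ j')) ∧ (isEven (toℕ j') ==ᵇ b))

  alternating-sym : ∀ b j j' → alternating b j j' ≡ alternating b j' j
  alternating-sym b j j' =
    ∨-comm ((toℕ j' ≡ᵇ cycNext m (toℕ j)) ∧ (isEven (toℕ j) ==ᵇ b)) ((toℕ j ≡ᵇ cycNext m (toℕ j')) ∧ (isEven (toℕ j') ==ᵇ b))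

  alternating⊆newAdj : ∀ b j j' → alternating b j j' ≡ true → newAdj j j' ≡ true
  alternating⊆newAdj b j j' e with ∨-elim e
  ... | inj₁ e′ with trans (sym (ringVertex-toℕ j')) (cong ringVertex (≡ᵇ-sound (∧-conicalˡ _ _ e′)))
  ...   | refl = newAdj-next j
  alternating⊆newAdj b j j' e | inj₂ e′ with trans (sym (ringVertex-toℕ j)) (cong ringVertex (≡ᵇ-sound (∧-conicalˡ _ _ e′)))
  ...   | refl = trans (newAdj-sym (next j') j') (newAdj-next j')

  alternating-next : ∀ b j → alternating b j (next j) ≡ (isEven (toℕ j) ==ᵇ b)
  alternating-next b j
    rewrite toℕ-next j | ≡ᵇ-refl (cycNext m (toℕ j))
          | ≢⇒≡ᵇ-false {toℕ j} {cycNext m (cycNext m (toℕ j))} (cycNext-cycNext≢ (toℕ<n j) m≥3 ∘ sym) =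
    ∨-identityʳ _

  alternating-prev : ∀ b j → alternating b j (prev j) ≡ (not (isEven (toℕ j)) ==ᵇ b)
  alternating-prev b j
    rewrite toℕ-prev j | cycNext-cycPrev (toℕ<n j) | ≡ᵇ-refl (toℕ j)
          | ≢⇒≡ᵇ-false {cycPrev m (toℕ j)} {cycNext m (toℕ j)} (cycPrev≢cycNext (toℕ<n j) m≥3)
          | isEven-cycPrev m-even (toℕ<n j) = refl

  alternating-covers : ∀ b j → countF (alternating b j) ≡ 1
  alternating-covers b j = begin
    countF (alternating b j)
      ≡⟨ countF-pair _ (next j) (prev j) (next≢prev j) (λ j' → newAdj-sound j j' ∘ alternating⊆newAdj b j j') ⟩
    ind (alternating b j (next j)) + ind (alternating b j (prev j))
      ≡⟨ cong₂ (λ x y → ind x + ind y) (alternating-next b j) (alternating-prev b j) ⟩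
    ind (isEven (toℕ j) ==ᵇ b) + ind (not (isEven (toℕ j)) ==ᵇ b)
      ≡⟨ exactly-one (isEven (toℕ j)) b ⟩
    1 ∎
    where
    open ≡-Reasoning
    exactly-one : ∀ x b → ind (x ==ᵇ b) + ind (not x ==ᵇ b) ≡ 1
    exactly-one true  true  = refl
    exactly-one true  false = refl
    exactly-one false true  = refl
    exactly-one false false = refl

  alternating-complementary : ∀ j j' → newAdj j j' ≡ true → alternating false j j' ≡ not (alternating true j j')
  alternating-complementary j j' e with newAdj-sound j j' e
  ... | inj₁ refl rewrite alternating-next false j | alternating-next true j
                         | ==ᵇ-false (isEven (toℕ j)) | ==ᵇ-true (isEven (toℕ j)) = refl
  ... | inj₂ refl rewrite alternating-prev false j | alternating-prev true j
                         | ==ᵇ-false (not (isEven (toℕ j))) | ==ᵇ-true (not (isEven (toℕ j))) = refl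

  extendBy : Bool → EdgeSet V → EdgeSet (V + m)
  extendBy b M x y with splitAt V x | splitAt V y
  ... | inj₁ u | inj₁ v  = M u v
  ... | inj₂ j | inj₂ j' = alternating b j j'
  ... | _      | _       = false

  restrictToOld : EdgeSet (V + m) → EdgeSet V
  restrictToOld M u v = M (old u) (old v)

  ringStart : Fin m
  ringStart = ringVertex 0

  ringLabel : EdgeSet (V + m) → Bool
  ringLabel M = M (new ringStart) (new (next ringStart))

  extendBy-old : ∀ b M u v → extendBy b M (old u) (old v) ≡ M u v
  extendBy-old b M u v rewrite splitAt-↑ˡ V u m | splitAt-↑ˡ V v m = refl
  extendBy-old-new : ∀ b M u j → extendBy b M (old u) (new j) ≡ false
  extendBy-old-new b M u j rewrite splitAt-↑ˡ V u m | splitAt-↑ʳ V m j = refl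
  extendBy-new-old : ∀ b M j u → extendBy b M (new j) (old u) ≡ false
  extendBy-new-old b M j u rewrite splitAt-↑ˡ V u m | splitAt-↑ʳ V m j = refl
  extendBy-new : ∀ b M j j' → extendBy b M (new j) (new j') ≡ alternating b j j'
  extendBy-new b M j j' rewrite splitAt-↑ʳ V m j | splitAt-↑ʳ V m j' = refl

  extendBy-cong : ∀ b {M M'} → M ≐ M' → extendBy b M ≐ extendBy b M'
  extendBy-cong b {M} {M'} e x y with old-or-new x | old-or-new y
  ... | inj₁ (u , refl) | inj₁ (v , refl) = trans (extendBy-old b M u v) (trans (e u v) (sym (extendBy-old b M' u v)))
  ... | inj₁ (u , refl) | inj₂ (j , refl) = trans (extendBy-old-new b M u j) (sym (extendBy-old-new b M' u j))
  ... | inj₂ (j , refl) | inj₁ (u , refl) = trans (extendBy-new-old b M j u) (sym (extendBy-new-old b M' j u))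
  ... | inj₂ (j , refl) | inj₂ (j' , refl) = trans (extendBy-new b M j j') (sym (extendBy-new b M' j j'))

  ringLabel-extendBy : ∀ b M → ringLabel (extendBy b M) ≡ b
  ringLabel-extendBy b M = begin
    extendBy b M (new ringStart) (new (next ringStart)) ≡⟨ extendBy-new b M ringStart (next ringStart) ⟩
    alternating b ringStart (next ringStart)            ≡⟨ alternating-next b ringStart ⟩
    (isEven (toℕ ringStart) ==ᵇ b)                      ≡⟨ cong (λ t → isEven t ==ᵇ b) (toℕ-ringVertex m≥1) ⟩
    b                                                   ∎
    where open ≡-Reasoning

  extendBy-kekule : ∀ b M → IsKekule G M → IsKekule G' (extendBy b M)
  extendBy-kekule b M kek = record { ⊆-edges = ⊆-edges′ ; symmetric = symmetric′ ; covers = covers′ }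
    where
    open IsKekule kek
    ⊆-edges′ : ∀ x y → extendBy b M x y ≡ true → adj' x y ≡ true
    ⊆-edges′ x y e with old-or-new x | old-or-new y
    ... | inj₁ (u , refl) | inj₁ (v , refl) = trans (adj'-old u v) (⊆-edges u v (trans (sym (extendBy-old b M u v)) e))
    ... | inj₁ (u , refl) | inj₂ (j , refl) = contradiction (trans (sym (extendBy-old-new b M u j)) e) λ ()
    ... | inj₂ (j , refl) | inj₁ (u , refl) = contradiction (trans (sym (extendBy-new-old b M j u)) e) λ ()
    ... | inj₂ (j , refl) | inj₂ (j' , refl) =
      trans (adj'-new j j') (alternating⊆newAdj b j j' (trans (sym (extendBy-new b M j j')) e))
    symmetric′ : ∀ x y → extendBy b M x y ≡ extendBy b M y x
    symmetric′ x y with old-or-new x | old-or-new y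
    ... | inj₁ (u , refl) | inj₁ (v , refl) =
      trans (extendBy-old b M u v) (trans (symmetric u v) (sym (extendBy-old b M v u)))
    ... | inj₁ (u , refl) | inj₂ (j , refl) = trans (extendBy-old-new b M u j) (sym (extendBy-new-old b M j u))
    ... | inj₂ (j , refl) | inj₁ (u , refl) = trans (extendBy-new-old b M j u) (sym (extendBy-old-new b M u j))
    ... | inj₂ (j , refl) | inj₂ (j' , refl) =
      trans (extendBy-new b M j j') (trans (alternating-sym b j j') (sym (extendBy-new b M j' j)))
    covers′ : ∀ x → vert' x ≡ true → countF (extendBy b M x) ≡ 1
    covers′ x vx with old-or-new x
    ... | inj₁ (u , refl) = begin
      countF (extendBy b M (old u))
        ≡⟨ countF-splitAt V (extendBy b M (old u)) ⟩
      countF (extendBy b M (old u) ∘ old) + countF (extendBy b M (old u) ∘ new)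
        ≡⟨ cong₂ _+_ (trans (countF-cong (extendBy-old b M u)) (covers u (trans (sym (vert'-old u)) vx)))
                     (countF-false (extendBy-old-new b M u)) ⟩
      1 ∎
      where open ≡-Reasoning
    ... | inj₂ (j , refl) = begin
      countF (extendBy b M (new j))
        ≡⟨ countF-splitAt V (extendBy b M (new j)) ⟩
      countF (extendBy b M (new j) ∘ old) + countF (extendBy b M (new j) ∘ new)
        ≡⟨ cong₂ _+_ (countF-false (extendBy-new-old b M j))
                     (trans (countF-cong (extendBy-new b M j)) (alternating-covers b j)) ⟩
      1 ∎
      where open ≡-Reasoning

  spoke-odd : ∀ u j → isEven (toℕ j) ≡ false → spoke u j ≡ false
  spoke-odd u j odd = anyF-false (λ p → cong (_∧ (lookup vs p =F u)) (≢⇒≡ᵇ-false (not-double p)))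
    where
    not-double : ∀ p → toℕ j ≢ 2 * toℕ p
    not-double p e = contradiction (trans (sym odd) (trans (cong isEven e) (isEven-double (toℕ p)))) λ ()

  module Restriction (M : EdgeSet (V + m)) (kek : IsKekule G' M) where
    open IsKekule kek

    spokesAt : ℕ → ℕ
    spokesAt t = countF (λ u → M (new (ringVertex t)) (old u))

    used : ℕ → Bool
    used t = M (new (ringVertex t)) (new (next (ringVertex t)))

    used-toℕ : ∀ j → used (toℕ j) ≡ M (new j) (new (next j))
    used-toℕ j = cong (λ z → M (new z) (new (next z))) (ringVertex-toℕ j)

    covered : ∀ t → t < m → spokesAt t + (ind (used t) + ind (used (cycPrev m t))) ≡ 1
    covered t t<m = begin
      spokesAt t + (ind (used t) + ind (used (cycPrev m t)))
        ≡⟨ cong (λ z → spokesAt t + (ind (used t) + ind z)) used-prev ⟨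
      countF (M (new j) ∘ old) + (ind (M (new j) (new (next j))) + ind (M (new j) (new (prev j))))
        ≡⟨ cong (countF (M (new j) ∘ old) +_) ring-part ⟨
      countF (M (new j) ∘ old) + countF (M (new j) ∘ new)
        ≡⟨ countF-splitAt V (M (new j)) ⟨
      countF (M (new j))
        ≡⟨ covers (new j) (vert'-new j) ⟩
      1 ∎
      where
      open ≡-Reasoning
      j = ringVertex t
      ring-part : countF (M (new j) ∘ new) ≡ ind (M (new j) (new (next j))) + ind (M (new j) (new (prev j)))
      ring-part = countF-pair _ (next j) (prev j) (next≢prev j)
        (λ j' e → newAdj-sound j j' (trans (sym (adj'-new j j')) (⊆-edges _ _ e)))
      used-prev : M (new j) (new (prev j)) ≡ used (cycPrev m t)
      used-prev = begin
        M (new j) (new (prev j))                ≡⟨ symmetric _ _ ⟩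
        M (new (prev j)) (new j)                ≡⟨ cong (M (new (prev j)) ∘ new) (next-prev j) ⟨
        M (new (prev j)) (new (next (prev j)))  ≡⟨ cong (λ z → used (cycPrev m z)) (toℕ-ringVertex t<m) ⟩
        used (cycPrev m t)                      ∎

    odd-no-spoke : ∀ t → t < m → isEven t ≡ false → spokesAt t ≡ 0
    odd-no-spoke t t<m odd = countF-false λ u → ¬-not λ e →
      contradiction (trans (sym (trans (sym (adj'-new-old (ringVertex t) u)) (⊆-edges _ _ e)))
                           (spoke-odd u (ringVertex t) (trans (cong isEven (toℕ-ringVertex t<m)) odd))) λ ()

    open AlternatingCycle m m-even m≥1 spokesAt used covered odd-no-spoke

    no-spoke : ∀ j u → M (new j) (old u) ≡ false
    no-spoke j u = countF-zero⇒false
      (trans (cong (λ z → countF (λ u → M (new z) (old u))) (sym (ringVertex-toℕ j)))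
             (proj₁ (no-spokes-and-alternates (toℕ j) (toℕ<n j)))) u

    used-alternating : ∀ j → M (new j) (new (next j)) ≡ alternating (ringLabel M) j (next j)
    used-alternating j = begin
      M (new j) (new (next j))                 ≡⟨ used-toℕ j ⟨
      used (toℕ j)                             ≡⟨ proj₂ (no-spokes-and-alternates (toℕ j) (toℕ<n j)) ⟩
      (isEven (toℕ j) ==ᵇ ringLabel M)         ≡⟨ alternating-next (ringLabel M) j ⟨
      alternating (ringLabel M) j (next j)     ∎
      where open ≡-Reasoning

    ring-part : ∀ j j' → M (new j) (new j') ≡ alternating (ringLabel M) j j'
    ring-part j j' with newAdj j j' in adjacent
    ... | false = trans (¬-not λ e → contradiction (trans (sym adjacent) (trans (sym (adj'-new j j')) (⊆-edges _ _ e))) λ ())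
                        (sym (¬-not λ e → contradiction (trans (sym adjacent) (alternating⊆newAdj _ j j' e)) λ ()))
    ... | true with newAdj-sound j j' adjacent
    ...   | inj₁ refl = used-alternating j
    ...   | inj₂ refl = begin
      M (new j) (new (prev j))                          ≡⟨ symmetric _ _ ⟩
      M (new (prev j)) (new j)                          ≡⟨ cong (M (new (prev j)) ∘ new) (next-prev j) ⟨
      M (new (prev j)) (new (next (prev j)))            ≡⟨ used-alternating (prev j) ⟩
      alternating (ringLabel M) (prev j) (next (prev j)) ≡⟨ cong (alternating (ringLabel M) (prev j)) (next-prev j) ⟩
      alternating (ringLabel M) (prev j) j              ≡⟨ alternating-sym _ (prev j) j ⟩
      alternating (ringLabel M) j (prev j)              ∎
      where open ≡-Reasoning

    restrict-kekule : IsKekule G (restrictToOld M)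
    restrict-kekule = record
      { ⊆-edges   = λ u v e → trans (sym (adj'-old u v)) (⊆-edges _ _ e)
      ; symmetric = λ u v → symmetric (old u) (old v)
      ; covers    = λ u vu → begin
          countF (restrictToOld M u)                            ≡⟨ +-identityʳ _ ⟨
          countF (M (old u) ∘ old) + 0                          ≡⟨ cong (countF (M (old u) ∘ old) +_) no-new ⟨
          countF (M (old u) ∘ old) + countF (M (old u) ∘ new)   ≡⟨ countF-splitAt V (M (old u)) ⟨
          countF (M (old u))                                    ≡⟨ covers (old u) (trans (vert'-old u) vu) ⟩
          1                                                     ∎ }
      where
      open ≡-Reasoning
      no-new : ∀ {u} → countF (M (old u) ∘ new) ≡ 0
      no-new {u} = countF-false (λ j → trans (symmetric _ _) (no-spoke j u))

    extend-restrict : extendBy (ringLabel M) (restrictToOld M) ≐ M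
    extend-restrict x y with old-or-new x | old-or-new y
    ... | inj₁ (u , refl) | inj₁ (v , refl) = extendBy-old _ _ u v
    ... | inj₁ (u , refl) | inj₂ (j , refl) = trans (extendBy-old-new _ _ u j) (sym (trans (symmetric _ _) (no-spoke j u)))
    ... | inj₂ (j , refl) | inj₁ (u , refl) = trans (extendBy-new-old _ _ j u) (sym (no-spoke j u))
    ... | inj₂ (j , refl) | inj₂ (j' , refl) = trans (extendBy-new _ _ j j') (sym (ring-part j j'))

  correspondence : ∀ b → KekuleCorrespondence G G' (λ M → ringLabel M ==ᵇ b)
  correspondence b = record
    { extend          = extendBy b
    ; restrict        = restrictToOld
    ; extend-cong     = extendBy-cong b
    ; restrict-cong   = λ e u v → e (old u) (old v)
    ; selected-cong   = λ e → cong (_==ᵇ b) (e _ _)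
    ; extend-kekule   = extendBy-kekule b
    ; extend-selected = λ M _ → subst (λ c → (c ==ᵇ b) ≡ true) (sym (ringLabel-extendBy b M)) (==ᵇ-refl b)
    ; restrict-kekule = λ M kek _ → Restriction.restrict-kekule M kek
    ; restrict-extend = extendBy-old b
    ; extend-restrict = λ M kek selected →
        subst (λ c → extendBy c (restrictToOld M) ≐ M) (==ᵇ⇒≡ selected) (Restriction.extend-restrict M kek)
    }

  kekuleCount-by-label : (P' : EdgeSet (V + m) → Bool) (P : Bool → EdgeSet V → Bool) →
    (∀ {M M'} → M ≐ M' → P' M ≡ P' M') → (∀ b {M M'} → M ≐ M' → P b M ≡ P b M') →
    (∀ b M → IsKekule G M → P' (extendBy b M) ≡ P b M) →
    kekuleCount G' P' ≡ kekuleCount G (P true) + kekuleCount G (P false)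
  kekuleCount-by-label P' P P'-cong P-cong P'-extend =
    trans (kekuleCount-split G' ringLabel P')
          (cong₂ _+_ (half true) (half false))
    where
    half : ∀ b → kekuleCount G' (λ M → (ringLabel M ==ᵇ b) ∧ P' M) ≡ kekuleCount G (P b)
    half b = kekuleCount-correspondence (correspondence b) P' (P b) P'-cong (P-cong b) (P'-extend b)

  numKekule-doubles : numKekule G' ≡ numKekule G + numKekule G
  numKekule-doubles = begin
    numKekule G'
      ≡⟨ numKekule-kekuleCount G' ⟩
    kekuleCount G' (λ _ → true)
      ≡⟨ kekuleCount-by-label _ (λ _ _ → true) (λ _ → refl) (λ _ _ → refl) (λ _ _ _ → refl) ⟩
    kekuleCount G (λ _ → true) + kekuleCount G (λ _ → true)
      ≡⟨ cong₂ _+_ (numKekule-kekuleCount G) (numKekule-kekuleCount G) ⟨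
    numKekule G + numKekule G ∎
    where open ≡-Reasoning

  containing-old-doubles : ∀ u v →
    numKekuleContaining G' (old u) (old v) ≡ numKekuleContaining G u v + numKekuleContaining G u v
  containing-old-doubles u v = begin
    numKekuleContaining G' (old u) (old v)
      ≡⟨ numKekuleContaining-kekuleCount G' _ _ ⟩
    kekuleCount G' (λ M → M (old u) (old v))
      ≡⟨ kekuleCount-by-label _ (λ _ M → M u v) (λ e → e _ _) (λ _ e → e u v) (λ b M _ → extendBy-old b M u v) ⟩
    kekuleCount G (λ M → M u v) + kekuleCount G (λ M → M u v)
      ≡⟨ cong₂ _+_ (numKekuleContaining-kekuleCount G u v) (numKekuleContaining-kekuleCount G u v) ⟨
    numKekuleContaining G u v + numKekuleContaining G u v ∎
    where open ≡-Reasoning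

  containing-new-edge : ∀ j j' → newAdj j j' ≡ true → numKekuleContaining G' (new j) (new j') ≡ numKekule G
  containing-new-edge j j' adjacent = begin
    numKekuleContaining G' (new j) (new j')
      ≡⟨ numKekuleContaining-kekuleCount G' _ _ ⟩
    kekuleCount G' (λ M → M (new j) (new j'))
      ≡⟨ kekuleCount-by-label _ (λ b _ → alternating b j j') (λ e → e _ _) (λ _ _ → refl) (λ b M _ → extendBy-new b M j j') ⟩
    kekuleCount G (λ _ → alternating true j j') + kekuleCount G (λ _ → alternating false j j')
      ≡⟨ cong₂ _+_ (kekuleCount-const G _) (kekuleCount-const G _) ⟩
    (if alternating true j j' then numKekule G else 0) + (if alternating false j j' then numKekule G else 0)
      ≡⟨ cong (λ c → (if alternating true j j' then numKekule G else 0) + (if c then numKekule G else 0))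
              (alternating-complementary j j' adjacent) ⟩
    (if alternating true j j' then numKekule G else 0) + (if not (alternating true j j') then numKekule G else 0)
      ≡⟨ one-side (alternating true j j') ⟩
    numKekule G ∎
    where
    open ≡-Reasoning
    one-side : ∀ c → (if c then numKekule G else 0) + (if not c then numKekule G else 0) ≡ numKekule G
    one-side true  = +-identityʳ _
    one-side false = refl

  containing-spoke-new-old : ∀ j u → numKekuleContaining G' (new j) (old u) ≡ 0
  containing-spoke-new-old j u = trans (numKekuleContaining-kekuleCount G' _ _)
    (kekuleCount-never G' _ (λ M kek → Restriction.no-spoke M kek j u))

  containing-spoke-old-new : ∀ u j → numKekuleContaining G' (old u) (new j) ≡ 0
  containing-spoke-old-new u j = trans (numKekuleContaining-kekuleCount G' _ _)
    (kekuleCount-never G' _ (λ M kek → trans (IsKekule.symmetric kek _ _) (Restriction.no-spoke M kek j u)))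

  spokeCount : Fin V → ℕ
  spokeCount u = countF (spoke u)

  deg'-old : ∀ u → deg G' (old u) ≡ deg G u + spokeCount u
  deg'-old u = trans (countF-splitAt V (adj' (old u)))
    (cong₂ _+_ (countF-cong (adj'-old u)) (countF-cong (adj'-old-new u)))

  deg'-odd-new : ∀ j → isEven (toℕ j) ≡ false → deg G' (new j) ≡ 2
  deg'-odd-new j odd = trans (countF-splitAt V (adj' (new j)))
    (cong₂ _+_ (countF-false (λ u → trans (adj'-new-old j u) (spoke-odd u j odd)))
               (trans (countF-cong (adj'-new j)) (newAdj-count j)))

  spoke-sound : ∀ u j → spoke u j ≡ true → u ∈ cyc i × vert u ≡ true × deg G u ≡ 2
  spoke-sound u j e with anyF-sound e
  ... | p , hit with =F-sound {x = lookup vs p} {u} (∧-conicalʳ (toℕ j ≡ᵇ 2 * toℕ p) _ hit)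
  ...   | refl with ∈-filter⁻ (λ v → T? (vert v ∧ (deg G v ≡ᵇ 2))) {xs = cyc i} (∈-lookup {xs = vs} p)
  ...     | u∈cyc , deg2 = let e′ = Equivalence.to T-≡ deg2 in
                           u∈cyc , ∧-conicalˡ _ _ e′ , ≡ᵇ-sound (∧-conicalʳ (vert (lookup vs p)) _ e′)

  spokeCount-off-cycle : Deg2Disjoint G k cyc → ∀ {i' u} → u ∈ cyc i' → i' ≢ i → spokeCount u ≡ 0
  spokeCount-off-cycle disjoint {i'} {u} u∈ i'≢i with spokeCount u in e
  ... | zero  = refl
  ... | suc _ with countF-suc⇒witness e
  ...   | j , is-spoke with spoke-sound u j is-spoke
  ...     | u∈cyc , vu , du = contradiction (disjoint i' i u u∈ u∈cyc vu du) i'≢i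

  length-deg2On : (H : Graph) (C : List (Fin (Graph.V H))) →
    length (deg2On H C) ≡ ∑[ v ∈ C ] ind (Graph.vert H v ∧ (deg H v ≡ᵇ 2))
  length-deg2On H C = length-filterᵇ _ C

  deg2On-old-cycle : Deg2Disjoint G k cyc → ∀ {i'} → i' ≢ i →
    length (deg2On G' (map old (cyc i'))) ≡ length (deg2On G (cyc i'))
  deg2On-old-cycle disjoint {i'} i'≢i = begin
    length (deg2On G' (map old (cyc i')))
      ≡⟨ length-deg2On G' (map old (cyc i')) ⟩
    ∑[ x ∈ map old (cyc i') ] ind (vert' x ∧ (deg G' x ≡ᵇ 2))
      ≡⟨ ∑-map old (cyc i') (λ x → ind (vert' x ∧ (deg G' x ≡ᵇ 2))) ⟩
    ∑[ u ∈ cyc i' ] ind (vert' (old u) ∧ (deg G' (old u) ≡ᵇ 2))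
      ≡⟨ ∑-cong-∈ (cyc i') same-status ⟩
    ∑[ u ∈ cyc i' ] ind (vert u ∧ (deg G u ≡ᵇ 2))
      ≡⟨ length-deg2On G (cyc i') ⟨
    length (deg2On G (cyc i')) ∎
    where
    open ≡-Reasoning
    same-status : ∀ u → u ∈ cyc i' → ind (vert' (old u) ∧ (deg G' (old u) ≡ᵇ 2)) ≡ ind (vert u ∧ (deg G u ≡ᵇ 2))
    same-status u u∈ = cong ind (cong₂ _∧_ (vert'-old u) (cong (_≡ᵇ 2) (begin
      deg G' (old u)            ≡⟨ deg'-old u ⟩
      deg G u + spokeCount u    ≡⟨ cong (deg G u +_) (spokeCount-off-cycle disjoint u∈ i'≢i) ⟩
      deg G u + 0               ≡⟨ +-identityʳ _ ⟩
      deg G u                   ∎)))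

  deg2On-new-cycle : 2 ≤ length (deg2On G' (map new (allFin m)))
  deg2On-new-cycle = subst (2 ≤_) (sym count) (two≤countF (ringVertex 1) (ringVertex 3) 1≢3 (odd-deg2 1 refl 1<m) (odd-deg2 3 refl m≥4))
    where
    isDeg2' : Fin m → Bool
    isDeg2' j = vert' (new j) ∧ (deg G' (new j) ≡ᵇ 2)
    count : length (deg2On G' (map new (allFin m))) ≡ countF isDeg2'
    count = trans (length-deg2On G' (map new (allFin m)))
      (trans (∑-map new (allFin m) (λ x → ind (vert' x ∧ (deg G' x ≡ᵇ 2)))) (∑-tabulate (λ j → j) isDeg2'))
    1<m : 1 < m
    1<m = ≤-trans (s≤s (s≤s z≤n)) m≥4
    1≢3 : ringVertex 1 ≢ ringVertex 3
    1≢3 e = contradiction (trans (sym (toℕ-ringVertex 1<m)) (trans (cong toℕ e) (toℕ-ringVertex m≥4))) λ ()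
    odd-deg2 : ∀ t → isEven t ≡ false → t < m → isDeg2' (ringVertex t) ≡ true
    odd-deg2 t odd t<m rewrite vert'-new (ringVertex t)
      | deg'-odd-new (ringVertex t) (trans (cong isEven (toℕ-ringVertex t<m)) odd) = refl

  old≢new : ∀ u j → old u ≢ new j
  old≢new u j e = contradiction (trans (sym (splitAt-↑ˡ V u m)) (trans (cong (splitAt V) e) (splitAt-↑ʳ V m j))) λ ()

-- Iterated altans

EmbeddedEdge : (G : Graph) {k : ℕ} (s : AState (Graph.V G) k) → Fin (AState.V s) → Fin (AState.V s) → Set
EmbeddedEdge G s u v = ∃₂ λ a b → AState.emb s a ≡ u × AState.emb s b ≡ v × Graph.adj G a b ≡ true

record AltanInvariant (G : Graph) {k : ℕ} (s : AState (Graph.V G) k) : Set where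
  open AState s
  field
    rich     : Deg2Rich (graphOf s) k cyc
    disjoint : Deg2Disjoint (graphOf s) k cyc
    kekulean : 0 < numKekule (graphOf s)
    old-edge : ∀ a b → Graph.adj G a b ≡ true →
      numKekuleContaining (graphOf s) (emb a) (emb b) * numKekule G ≡ numKekuleContaining G a b * numKekule (graphOf s)
    new-edge : ∀ u v → adj u v ≡ true → ¬ EmbeddedEdge G s u v →
      (spk u v ≡ true → numKekuleContaining (graphOf s) u v ≡ 0) ×
      (spk u v ≡ false → numKekuleContaining (graphOf s) u v * 2 ≡ numKekule (graphOf s))

module Preservation (G : Graph) {k : ℕ} (s : AState (Graph.V G) k) (i : Fin k) (inv : AltanInvariant G s) where
  open AltanInvariant inv
  open AState s
  open OneAltan s i (rich i) hiding (G)
  open AltanStep s i using (result; adj'; spk'; vert'; newAdj)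

  private
    K K' : ℕ
    K  = numKekule (graphOf s)
    K' = numKekule G'

  rich' : Deg2Rich G' k (AState.cyc result)
  rich' i' with i' ≟ i
  ... | yes refl = deg2On-new-cycle
  ... | no i'≢i  = subst (2 ≤_) (sym (deg2On-old-cycle disjoint i'≢i)) (rich i')

  disjoint' : Deg2Disjoint G' k (AState.cyc result)
  disjoint' i₁ i₂ x x∈₁ x∈₂ vx dx with i₁ ≟ i | i₂ ≟ i
  ... | yes refl | yes refl = refl
  ... | yes _ | no _ with ∈-map⁻ new x∈₁ | ∈-map⁻ old x∈₂
  ...   | j , _ , refl | u , _ , e = contradiction (sym e) (old≢new u j)
  disjoint' i₁ i₂ x x∈₁ x∈₂ vx dx | no _ | yes _ with ∈-map⁻ old x∈₁ | ∈-map⁻ new x∈₂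
  ...   | u , _ , refl | j , _ , e = contradiction e (old≢new u j)
  disjoint' i₁ i₂ x x∈₁ x∈₂ vx dx | no i₁≢i | no _ with ∈-map⁻ old x∈₁ | ∈-map⁻ old x∈₂
  ...   | u , u∈₁ , refl | u' , u'∈₂ , e with ↑ˡ-injective m u u' e
  ...     | refl = disjoint i₁ i₂ u u∈₁ u'∈₂ (trans (sym (vert'-old u)) vx) (begin
    deg (graphOf s) u                   ≡⟨ +-identityʳ _ ⟨
    deg (graphOf s) u + 0               ≡⟨ cong (deg (graphOf s) u +_) (spokeCount-off-cycle disjoint u∈₁ i₁≢i) ⟨
    deg (graphOf s) u + spokeCount u    ≡⟨ deg'-old u ⟨
    deg G' (old u)                      ≡⟨ dx ⟩
    2                                   ∎)
    where open ≡-Reasoning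

  kekulean' : 0 < K'
  kekulean' = subst (0 <_) (sym numKekule-doubles) (≤-trans kekulean (m≤m+n K K))

  old-edge' : ∀ a b → Graph.adj G a b ≡ true →
    numKekuleContaining G' (old (emb a)) (old (emb b)) * numKekule G ≡ numKekuleContaining G a b * K'
  old-edge' a b ab = begin
    numKekuleContaining G' (old (emb a)) (old (emb b)) * numKekule G   ≡⟨ cong (_* numKekule G) (containing-old-doubles _ _) ⟩
    (c + c) * numKekule G                                              ≡⟨ *-distribʳ-+ (numKekule G) c c ⟩
    c * numKekule G + c * numKekule G                                  ≡⟨ cong₂ _+_ (old-edge a b ab) (old-edge a b ab) ⟩
    numKekuleContaining G a b * K + numKekuleContaining G a b * K      ≡⟨ *-distribˡ-+ (numKekuleContaining G a b) K K ⟨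
    numKekuleContaining G a b * (K + K)                                ≡⟨ cong (numKekuleContaining G a b *_) numKekule-doubles ⟨
    numKekuleContaining G a b * K'                                     ∎
    where
    open ≡-Reasoning
    c = numKekuleContaining (graphOf s) (emb a) (emb b)

  new-edge' : ∀ x y → adj' x y ≡ true → ¬ EmbeddedEdge G result x y →
    (spk' x y ≡ true → numKekuleContaining G' x y ≡ 0) ×
    (spk' x y ≡ false → numKekuleContaining G' x y * 2 ≡ K')
  new-edge' x y xy not-embedded with old-or-new x | old-or-new y
  ... | inj₁ (u , refl) | inj₁ (v , refl) =
    (λ spoke → trans (containing-old-doubles u v) (cong (λ c → c + c) (proj₁ before (trans (sym (spk'-old u v)) spoke)))) ,
    (λ non-spoke → begin
      numKekuleContaining G' (old u) (old v) * 2       ≡⟨ cong (_* 2) (containing-old-doubles u v) ⟩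
      (c + c) * 2                                       ≡⟨ *-distribʳ-+ 2 c c ⟩
      c * 2 + c * 2                                     ≡⟨ cong (λ z → z + z) (proj₂ before (trans (sym (spk'-old u v)) non-spoke)) ⟩
      K + K                                             ≡⟨ numKekule-doubles ⟨
      K'                                                ∎)
    where
    open ≡-Reasoning
    c = numKekuleContaining (graphOf s) u v
    before = new-edge u v (trans (sym (adj'-old u v)) xy)
      (λ (a , b , ea , eb , ab) → not-embedded (a , b , cong old ea , cong old eb , ab))
  ... | inj₁ (u , refl) | inj₂ (j , refl) =
    (λ _ → containing-spoke-old-new u j) ,
    (λ non-spoke → contradiction (trans (sym non-spoke) (trans (spk'-old-new u j) (trans (sym (adj'-old-new u j)) xy))) λ ())
  ... | inj₂ (j , refl) | inj₁ (u , refl) =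
    (λ _ → containing-spoke-new-old j u) ,
    (λ non-spoke → contradiction (trans (sym non-spoke) (trans (spk'-new-old j u) (trans (sym (adj'-new-old j u)) xy))) λ ())
  ... | inj₂ (j , refl) | inj₂ (j' , refl) =
    (λ spoke → contradiction (trans (sym (spk'-new j j')) spoke) λ ()) ,
    (λ _ → begin
      numKekuleContaining G' (new j) (new j') * 2       ≡⟨ cong (_* 2) (containing-new-edge j j' (trans (sym (adj'-new j j')) xy)) ⟩
      K * 2                                             ≡⟨ *-comm K 2 ⟩
      K + (K + 0)                                       ≡⟨ cong (K +_) (+-identityʳ K) ⟩
      K + K                                             ≡⟨ numKekule-doubles ⟨
      K'                                                ∎)
    where open ≡-Reasoning

  preserved : AltanInvariant G result
  preserved = record
    { rich = rich' ; disjoint = disjoint' ; kekulean = kekulean' ; old-edge = old-edge' ; new-edge = new-edge' }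

iter-preserves : {A : Set} (P : A → Set) {f : A → A} → (∀ {a} → P a → P (f a)) → ∀ p {a} → P a → P (iter p f a)
iter-preserves P step zero    pa = pa
iter-preserves P step (suc p) pa = step (iter-preserves P step p pa)

foldl-preserves : {A B : Set} (P : A → Set) {f : A → B → A} → (∀ {a} b → P a → P (f a b)) →
  ∀ bs {a} → P a → P (foldl f a bs)
foldl-preserves P step []       pa = pa
foldl-preserves P step (b ∷ bs) pa = foldl-preserves P step bs (step b pa)

altanIter-preserves : (G : Graph) {k : ℕ} (ns : Fin k → ℕ) {s : AState (Graph.V G) k} →
  AltanInvariant G s → AltanInvariant G (altanIter ns s)
altanIter-preserves G ns = foldl-preserves (AltanInvariant G)
  (λ i → iter-preserves (AltanInvariant G) (λ {t} → Preservation.preserved G t i) (ns i)) (allFin _)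

initial-invariant : (G : Graph) (k : ℕ) (C : Fin k → List (Fin (Graph.V G))) →
  Admissible G k C → 0 < numKekule G → AltanInvariant G (initState G k C)
initial-invariant G k C (_ , rich , disjoint) kekulean = record
  { rich     = rich
  ; disjoint = disjoint
  ; kekulean = kekulean
  ; old-edge = λ _ _ _ → refl
  ; new-edge = λ u v uv not-embedded → contradiction (u , v , refl , refl , uv) not-embedded }

corollary5p5 :
  (G0 : PlaneCubicGraph) (P : Dart (PlaneCubicGraph.n G0) → Bool) →
  IsPerforatedPatch G0 P →
  (k : ℕ) (C : Fin k → List (Fin (PlaneCubicGraph.n G0))) →
  HolePerimeters G0 P k C →
  Admissible (skeleton G0 P) k C →
  0 < numKekule (skeleton G0 P) →
  (ns : Fin k → ℕ) →
  let G  = skeleton G0 P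
      S  = altanIter ns (initState G k C)
      G' = graphOf S
  in ((u v : Fin (AState.V S)) → AState.adj S u v ≡ true →
        ¬ (∃₂ λ a b → AState.emb S a ≡ u × AState.emb S b ≡ v × Graph.adj G a b ≡ true) →
        (AState.spk S u v ≡ true → pauling G' u v ≡ 0ℚ) ×
        (AState.spk S u v ≡ false → pauling G' u v ≡ ½))
   × ((a b : Fin (Graph.V G)) → Graph.adj G a b ≡ true →
        pauling G' (AState.emb S a) (AState.emb S b) ≡ pauling G a b)
corollary5p5 G0 P _ k C _ admissible kekulean ns =
  (λ u v uv not-embedded →
     let spoke , non-spoke = new-edge u v uv not-embedded
     in pauling-zero G' u v kekulean′ ∘ spoke , pauling-half G' u v kekulean′ ∘ non-spoke) ,
  (λ a b ab → pauling-cross G' _ _ G a b kekulean′ kekulean (old-edge a b ab))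
  where
  G  = skeleton G0 P
  G' = graphOf (altanIter ns (initState G k C))
  open AltanInvariant (altanIter-preserves G ns (initial-invariant G k C admissible kekulean))
    renaming (kekulean to kekulean′)
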